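{- For every SAP instance, the algorithm GREEDY run with the empty initial seminar selection $S_0$ (i.e. $S_0(b)=0$ for all $b\in B$) outputs a feasible seminar assignment whose profit is at least $\frac{1}{2}(1-e^{ -1})$ times the maximum profit of a feasible seminar assignment.
   Context: SAP instance: finite set $B$ of seminars, finite set $I$ of students, for each $b\in B$ a set $K_b\subseteq\mathbb{N}$ of allowable numbers of students with $0\in K_b$, profits $p(i,b)\ge 0$. A seminar assignment is $\mathcal{A}:J\to B$ with $J\subseteq I$, feasible if $|\mathcal{A}^{ -1}(b)|\in K_b$ for all $b$, with profit $p(\mathcal{A})=\sum_{i\in J}p(i,\mathcal{A}(i))$. A seminar selection is $S:B\to\mathbb{N}$ with $S(b)\in K_b$ for all $b$; it is feasible if $\sum_b S(b)\le |I|$. $p(S)$ is the maximum profit of an assignment assigning exactly $S(b)$ students to each $b$, and $\mathcal{A}_S$ denotes such an optimal assignment. The cost is $c(S)=\sum_b S(b)$. Write $T\succ S$ if $T(b)\ge S(b)$ for all $b$ and $T(b)>S(b)$ for some $b$; $inc(S)$ is the set of feasible selections $T\succ S$ with $T(b)>S(b)$ for exactly one $b$. Algorithm GREEDY with feasible initial selection $S_0$: set $i=0$; while $inc(S_i)\neq\emptyset$, let $S_{i+1}$ be an element of $inc(S_i)$ maximizing $\frac{p(S')-p(S_i)}{c(S')-c(S_i)}$ over $S'\in inc(S_i)$ and increase $i$ by one. Let $\mathcal{A}_1=\mathcal{A}_{S_i}$ for the final $i$. Let $\mathcal{A}_2$ be a feasible assignment of maximum profit among feasible assignments that assign students to only a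 single seminar $b$, where $b$ ranges over seminars with $S_0(b)=0$. Output whichever of $\mathcal{A}_1,\mathcal{A}_2$ has larger profit.
   Formalization: The profits $p(i,b)$ take values in the nonnegative rationals instead of the reals. -}

module Defs where

open import Data.Nat as ℕ using (ℕ; zero; suc)
open import Data.Fin using (Fin; zero; suc)
open import Data.Fin.Properties using () renaming (_≟_ to _≟ᶠ_)
open import Data.Maybe using (Maybe; just; nothing)
open import Data.Bool using (Bool; true; false)
open import Data.Integer using (+_)
open import Data.Rational using (ℚ; 0ℚ; 1ℚ; _+_; _-_; _*_; _≤_; _<_; _/_)
open import Data.Product using (Σ; ∃; _×_)
open import Data.Empty using (⊥)
open import Relation.Nullary using (¬_)
open import Relation.Nullary.Decidable using (isYes)
open import Relation.Binary.PropositionalEquality using (_≡_; _≢_)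

sumℕ : ∀ {k} → (Fin k → ℕ) → ℕ
sumℕ {zero}  f = 0
sumℕ {suc k} f = f zero ℕ.+ sumℕ (λ i → f (suc i))

sumℚ : ∀ {k} → (Fin k → ℚ) → ℚ
sumℚ {zero}  f = 0ℚ
sumℚ {suc k} f = f zero + sumℚ (λ i → f (suc i))

count : ∀ {k} → (Fin k → Bool) → ℕ
count {zero}  f = 0
count {suc k} f = (if f zero then 1 else 0) ℕ.+ count (λ i → f (suc i))
  where open import Data.Bool using (if_then_else_)

-- SAP instances
-- n students (I = Fin n), m seminars (B = Fin m),
-- K b : the set K_b ⊆ ℕ of allowable sizes (0 ∈ K_b),
-- p i b : profit, nonnegative (rational).

record SAP : Set₁ where
  field
    n   : ℕ
    m   : ℕ
    K   : Fin m → ℕ → Set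
    K0  : ∀ b → K b 0
    p   : Fin n → Fin m → ℚ
    p≥0 : ∀ i b → 0ℚ ≤ p i b

module _ (P : SAP) where
  open SAP P

  -- A seminar assignment A : J → B with J ⊆ I, encoded as I → Maybe B
  -- (A i = nothing means i ∉ J).
  Assignment : Set
  Assignment = Fin n → Maybe (Fin m)

  isAt : Maybe (Fin m) → Fin m → Bool
  isAt nothing  b = false
  isAt (just c) b = isYes (c ≟ᶠ b)

  load : Assignment → Fin m → ℕ
  load A b = count (λ i → isAt (A i) b)

  FeasibleAssignment : Assignment → Set
  FeasibleAssignment A = ∀ b → K b (load A b)

  gain : Maybe (Fin m) → Fin n → ℚ
  gain nothing  i = 0ℚ
  gain (just b) i = p i b

  profit : Assignment → ℚ
  profit A = sumℚ (λ i → gain (A i) i)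

  Selection : Set
  Selection = Fin m → ℕ

  IsSelection : Selection → Set
  IsSelection S = ∀ b → K b (S b)

  cost : Selection → ℕ
  cost S = sumℕ S

  FeasibleSelection : Selection → Set
  FeasibleSelection S = IsSelection S × cost S ℕ.≤ n

  Realizes : Selection → Assignment → Set
  Realizes S A = ∀ b → load A b ≡ S b

  -- A is an optimal assignment A_S for S (so profit A = p(S))
  OptFor : Selection → Assignment → Set
  OptFor S A = Realizes S A × (∀ A' → Realizes S A' → profit A' ≤ profit A)

  Inc : Selection → Selection → Set
  Inc S T = FeasibleSelection T
          × (∃ λ b → S b ℕ.< T b × (∀ b' → b' ≢ b → T b' ≡ S b'))

  -- (p(T)-p(S))/(c(T)-c(S)) ≤ (p(S')-p(S))/(c(S')-c(S)), cross-multiplied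
  -- (both denominators are positive for T, S' ∈ inc(S)).
  ratioLE : ℚ → ℕ → ℚ → ℕ → ℚ → ℕ → Set
  ratioLE pS cS pT cT pS' cS' =
    (pT - pS) * (+ (cS' ℕ.∸ cS) / 1) ≤ (pS' - pS) * (+ (cT ℕ.∸ cS) / 1)

  GreedyStep : Selection → Selection → Set
  GreedyStep S S' =
    Inc S S' ×
    (∀ T → Inc S T → ∀ AS AT AS' → OptFor S AS → OptFor T AT → OptFor S' AS' →
       ratioLE (profit AS) (cost S) (profit AT) (cost T) (profit AS') (cost S'))

  data GreedyRun (S : Selection) : Selection → Set where
    stop : (∀ T → ¬ Inc S T) → GreedyRun S S
    step : ∀ {S' F} → GreedyStep S S' → GreedyRun S' F → GreedyRun S F

  SingleSeminar : Selection → Assignment → Set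
  SingleSeminar S₀ A = ∃ λ b → S₀ b ≡ 0 × (∀ i → A i ≡ nothing ⊎' A i ≡ just b)
    where open import Data.Sum using () renaming (_⊎_ to _⊎'_)

  IsA2 : Selection → Assignment → Set
  IsA2 S₀ A = FeasibleAssignment A × SingleSeminar S₀ A ×
              (∀ A' → FeasibleAssignment A' → SingleSeminar S₀ A' → profit A' ≤ profit A)

  S-empty : Selection
  S-empty b = 0

-- The constant ½(1 - e⁻¹), via rationals below it.
-- (k/(k+1))^k decreases strictly to e⁻¹, hence for r : ℚ,
--   e⁻¹ < r  ⇔  ∃ k, (k/(k+1))^k < r,
-- and  q < ½(1 - e⁻¹)  ⇔  e⁻¹ < 1 - 2q.

_^ℚ_ : ℚ → ℕ → ℚ
x ^ℚ zero  = 1ℚ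
x ^ℚ suc k = x * (x ^ℚ k)

BelowHalfOneMinusInvE : ℚ → Set
BelowHalfOneMinusInvE q =
  ∃ λ k → ((+ k / suc k) ^ℚ k) < 1ℚ - (q + q)

-- x ≥ ½(1 - e⁻¹) · y  (for y ≥ 0) expressed as: q·y ≤ x for every rational q < ½(1-e⁻¹)
AtLeastConstTimes : ℚ → ℚ → Set
AtLeastConstTimes x y = ∀ q → BelowHalfOneMinusInvE q → q * y ≤ x

{-# OPTIONS --safe #-}

-- Fix a feasible assignment A*, a selection S reached by GREEDY with an optimal assignment A_S, and let
-- δ_b = |A*⁻¹(b)| ∸ S(b). Pairing each student that A* moves into a seminar with a distinct student that
-- A_S has there, and following the resulting chains, splits p(A*) − p(A_S) into gains g_b, where g_b is
-- realised within the capacities of S raised by δ_b in seminar b. Each g_b is at most p(A₂), because the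
-- students moving into b form a single-seminar assignment. Let b maximise g_b / δ_b. If raising b still
-- fits into n students, GREEDY's step gains at rate at least g_b / δ_b ≥ (p(A*) − p(A_S)) / n, so each
-- unit of cost shrinks the gap by the factor 1 − 1/n; if it does not fit, the gap minus g_b is already
-- below (1 − 1/n)^n p(A*). Either way p(A*) − p(A₁) − p(A₂) ≤ (1 − 1/n)^n p(A*), and
-- (1 − 1/n)^n ≤ (k/(k+1))^k for every k gives max(p(A₁), p(A₂)) ≥ ½(1 − e⁻¹) p(A*).

module Submission where

module PowerBounds where

  open import Data.Nat using (ℕ; zero; suc; _+_; _*_; _^_; _∸_; _≤_; _<_; z≤n; NonZero)
  open import Data.Nat.Properties
  open import Data.Nat.Tactic.RingSolver using (solve-∀)
  open import Data.Sum using (inj₁; inj₂)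
  open import Relation.Binary.PropositionalEquality

  ^-distribʳ-* : ∀ a b k → (a * b) ^ k ≡ a ^ k * b ^ k
  ^-distribʳ-* a b zero    = refl
  ^-distribʳ-* a b (suc k) = trans (cong (a * b *_) (^-distribʳ-* a b k)) (interchange a b (a ^ k) (b ^ k))
    where
    interchange : ∀ a b x y → a * b * (x * y) ≡ a * x * (b * y)
    interchange = solve-∀

  -- Bernoulli's inequality (1 - 1/w)^k ≥ 1 - k/w for w = v + 1, cleared of denominators.
  bernoulli⁻ : ∀ v k → suc v ^ suc k ≤ v ^ k * suc v + k * suc v ^ k
  bernoulli⁻ v zero = ≤-reflexive (base v)
    where
    base : ∀ v → (1 + v) * 1 ≡ 1 * (1 + v) + 0
    base = solve-∀
  bernoulli⁻ v (suc k) = begin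
    w * (w * w^k)                              ≤⟨ *-monoʳ-≤ w (bernoulli⁻ v k) ⟩
    w * (v^k * w + k * w^k)                    ≡⟨ expand v v^k k w^k ⟩
    v * v^k * w + v^k * w + k * (w * w^k)      ≤⟨ +-monoˡ-≤ (k * (w * w^k)) (+-monoʳ-≤ (v * v^k * w) v^k*w≤w^k*w) ⟩
    v * v^k * w + w * w^k + k * (w * w^k)      ≡⟨ +-assoc (v * v^k * w) (w * w^k) (k * (w * w^k)) ⟩
    v * v^k * w + suc k * (w * w^k)            ∎
    where
    open ≤-Reasoning
    w v^k w^k : ℕ
    w = suc v
    v^k = v ^ k
    w^k = suc v ^ k
    expand : ∀ v p k q → (1 + v) * (p * (1 + v) + k * q) ≡ v * p * (1 + v) + p * (1 + v) + k * ((1 + v) * q)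
    expand = solve-∀
    v^k*w≤w^k*w : v^k * w ≤ w * w^k
    v^k*w≤w^k*w = ≤-trans (*-monoˡ-≤ w (^-monoˡ-≤ k (n≤1+n v))) (≤-reflexive (*-comm w^k w))

  -- Bernoulli's inequality (1 + 1/v)^r ≥ 1 + r/v, cleared of denominators.
  bernoulli⁺ : ∀ v r → v ^ r * (v + r) ≤ v * suc v ^ r
  bernoulli⁺ v zero = ≤-reflexive (base v)
    where
    base : ∀ v → 1 * (v + 0) ≡ v * 1
    base = solve-∀
  bernoulli⁺ v (suc r) = begin
    v * v^r * (v + suc r)                 ≤⟨ m≤m+n (v * v^r * (v + suc r)) (v^r * r) ⟩
    v * v^r * (v + suc r) + v^r * r       ≡⟨ regroup v v^r r ⟩
    suc v * (v^r * (v + r))               ≤⟨ *-monoʳ-≤ (suc v) (bernoulli⁺ v r) ⟩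
    suc v * (v * suc v ^ r)               ≡⟨ x*[y*z]≡y*[x*z] (suc v) v (suc v ^ r) ⟩
    v * (suc v * suc v ^ r)               ∎
    where
    open ≤-Reasoning
    v^r : ℕ
    v^r = v ^ r
    regroup : ∀ v p r → v * p * (v + (1 + r)) + p * r ≡ (1 + v) * (p * (v + r))
    regroup = solve-∀
    x*[y*z]≡y*[x*z] : ∀ x y z → x * (y * z) ≡ y * (x * z)
    x*[y*z]≡y*[x*z] = solve-∀

  -- (1 - 1/n)^c ≥ 1 - c/n, cleared of denominators.
  pow-≥-linear : ∀ n c → n ^ c * (n ∸ c) ≤ n * (n ∸ 1) ^ c
  pow-≥-linear zero    zero    = z≤n
  pow-≥-linear zero    (suc c) = z≤n
  pow-≥-linear (suc v) c = begin
    suc v ^ c * (suc v ∸ c)                     ≡⟨ *-distribˡ-∸ (suc v ^ c) (suc v) c ⟩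
    suc v ^ c * suc v ∸ suc v ^ c * c           ≡⟨ cong₂ _∸_ (*-comm (suc v ^ c) (suc v)) (*-comm (suc v ^ c) c) ⟩
    suc v ^ suc c ∸ c * suc v ^ c               ≤⟨ ∸-monoˡ-≤ (c * suc v ^ c) (bernoulli⁻ v c) ⟩
    v ^ c * suc v + c * suc v ^ c ∸ c * suc v ^ c ≡⟨ m+n∸n≡m (v ^ c * suc v) (c * suc v ^ c) ⟩
    v ^ c * suc v                               ≡⟨ *-comm (v ^ c) (suc v) ⟩
    suc v * v ^ c                               ∎
    where open ≤-Reasoning

  -- p / q ≤ r / s, cleared of denominators; a record so that p, q, r, s stay inferable.
  infix 4 _÷_≼_÷_
  record _÷_≼_÷_ (p q r s : ℕ) : Set where
    constructor cross
    field uncross : p * s ≤ r * q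

  open _÷_≼_÷_

  ≼-trans : ∀ {p q r s t u} → 0 < s → p ÷ q ≼ r ÷ s → r ÷ s ≼ t ÷ u → p ÷ q ≼ t ÷ u
  ≼-trans {p} {q} {r} {s@(suc _)} {t} {u} _ (cross ps≤rq) (cross ru≤ts) = cross (*-cancelʳ-≤ (p * u) (t * q) s (begin
    p * u * s     ≡⟨ xy∙z≈xz∙y p u s ⟩
    p * s * u     ≤⟨ *-monoˡ-≤ u ps≤rq ⟩
    r * q * u     ≡⟨ xy∙z≈xz∙y r q u ⟩
    r * u * q     ≤⟨ *-monoˡ-≤ q ru≤ts ⟩
    t * s * q     ≡⟨ xy∙z≈xz∙y t s q ⟩
    t * q * s     ∎))
    where
    open ≤-Reasoning
    xy∙z≈xz∙y : ∀ x y z → x * y * z ≡ x * z * y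
    xy∙z≈xz∙y = solve-∀

  -- Both tend to e⁻¹: lower a = (a/(a+1))^(a+1) increases and upper k = (k/(k+1))^k decreases.

  -- For a ≥ 1 put v = a(a+2), so that (a+1)² = v + 1: the step is Bernoulli's inequality for 1/v.
  lower-step : ∀ a → a ^ suc a ÷ suc a ^ suc a ≼ suc a ^ (2 + a) ÷ (2 + a) ^ (2 + a)
  lower-step zero    = cross z≤n
  lower-step (suc a′) = cross (*-cancelʳ-≤ _ _ v (begin
    a ^ suc a * (2 + a) ^ (2 + a) * v                ≡⟨ regroup (a ^ suc a) ((2 + a) ^ suc a) (2 + a) v ⟩
    a ^ suc a * (2 + a) ^ suc a * ((2 + a) * v)      ≡⟨ cong (_* ((2 + a) * v)) (^-distribʳ-* a (2 + a) (suc a)) ⟨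
    v ^ suc a * ((2 + a) * v)                        ≤⟨ *-monoʳ-≤ (v ^ suc a) poly ⟩
    v ^ suc a * ((v + suc a) * suc a)                ≡⟨ *-assoc (v ^ suc a) (v + suc a) (suc a) ⟨
    v ^ suc a * (v + suc a) * suc a                  ≤⟨ *-monoˡ-≤ (suc a) (bernoulli⁺ v (suc a)) ⟩
    v * suc v ^ suc a * suc a                        ≡⟨ cong (λ z → v * z ^ suc a * suc a) 1+v≡[1+a]² ⟩
    v * (suc a * suc a) ^ suc a * suc a              ≡⟨ cong (λ z → v * z * suc a) (^-distribʳ-* (suc a) (suc a) (suc a)) ⟩
    v * (suc a ^ suc a * suc a ^ suc a) * suc a      ≡⟨ regroup′ v (suc a ^ suc a) (suc a) ⟩
    suc a ^ (2 + a) * suc a ^ suc a * v              ∎))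
    where
    open ≤-Reasoning
    a v : ℕ
    a = suc a′
    v = a * (2 + a)
    instance
      v≢0 : NonZero v
      v≢0 = _
    1+v≡[1+a]² : suc v ≡ suc a * suc a
    1+v≡[1+a]² = square a
      where
      square : ∀ a → 1 + a * (2 + a) ≡ (1 + a) * (1 + a)
      square = solve-∀
    poly : (2 + a) * v ≤ (v + suc a) * suc a
    poly = ≤-trans (n≤1+n _) (≤-reflexive (expand a))
      where
      expand : ∀ a → 1 + (2 + a) * (a * (2 + a)) ≡ (a * (2 + a) + (1 + a)) * (1 + a)
      expand = solve-∀
    regroup : ∀ x y z v → x * (z * y) * v ≡ x * y * (z * v)
    regroup = solve-∀
    regroup′ : ∀ v x s → v * (x * x) * s ≡ s * x * x * v
    regroup′ = solve-∀

  -- Put v = k(k+2) and w = k² + k + 1, so that (k+1)² = v + 1 = w + k: Bernoulli's inequality for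
  -- 1/(v+1) gives w (v+1)^k ≤ v^k (v+1).
  upper-step : ∀ k → suc k ^ suc k ÷ (2 + k) ^ suc k ≼ k ^ k ÷ suc k ^ k
  upper-step k = cross (begin
    suc k ^ suc k * suc k ^ k              ≡⟨ *-assoc (suc k) (suc k ^ k) (suc k ^ k) ⟩
    suc k * (suc k ^ k * suc k ^ k)        ≡⟨ cong (suc k *_) (^-distribʳ-* (suc k) (suc k) k) ⟨
    suc k * (suc k * suc k) ^ k            ≡⟨ cong (λ z → suc k * z ^ k) 1+v≡[1+k]² ⟨
    suc k * Q                              ≤⟨ *-cancelʳ-≤ (suc k * Q) (v ^ k * (2 + k)) w main ⟩
    v ^ k * (2 + k)                        ≡⟨ cong (_* (2 + k)) (^-distribʳ-* k (2 + k) k) ⟩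
    k ^ k * (2 + k) ^ k * (2 + k)          ≡⟨ regroup (k ^ k) ((2 + k) ^ k) (2 + k) ⟩
    k ^ k * (2 + k) ^ suc k                ∎)
    where
    open ≤-Reasoning
    v w Q : ℕ
    v = k * (2 + k)
    w = suc (k + k * k)
    Q = suc v ^ k
    1+v≡[1+k]² : suc v ≡ suc k * suc k
    1+v≡[1+k]² = square k
      where
      square : ∀ k → 1 + k * (2 + k) ≡ (1 + k) * (1 + k)
      square = solve-∀
    wQ≤ : w * Q ≤ v ^ k * suc v
    wQ≤ = +-cancelʳ-≤ (k * Q) (w * Q) (v ^ k * suc v)
            (subst (_≤ v ^ k * suc v + k * Q) (trans (cong (_* Q) (split k)) (*-distribʳ-+ Q w k)) (bernoulli⁻ v k))
      where
      split : ∀ k → 1 + k * (2 + k) ≡ (1 + (k + k * k)) + k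
      split = solve-∀
    poly : suc v * suc k ≤ (2 + k) * w
    poly = ≤-trans (n≤1+n _) (≤-reflexive (expand k))
      where
      expand : ∀ k → 1 + (1 + k * (2 + k)) * (1 + k) ≡ (2 + k) * (1 + (k + k * k))
      expand = solve-∀
    main : suc k * Q * w ≤ v ^ k * (2 + k) * w
    main = begin
      suc k * Q * w                ≡⟨ regroup″ (suc k) Q w ⟩
      w * Q * suc k                ≤⟨ *-monoˡ-≤ (suc k) wQ≤ ⟩
      v ^ k * suc v * suc k        ≡⟨ *-assoc (v ^ k) (suc v) (suc k) ⟩
      v ^ k * (suc v * suc k)      ≤⟨ *-monoʳ-≤ (v ^ k) poly ⟩
      v ^ k * ((2 + k) * w)        ≡⟨ *-assoc (v ^ k) (2 + k) w ⟨
      v ^ k * (2 + k) * w          ∎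
      where
      regroup″ : ∀ s q w → s * q * w ≡ w * q * s
      regroup″ = solve-∀
    regroup : ∀ x y t → x * y * t ≡ x * (t * y)
    regroup = solve-∀

  lower≼upper-diagonal : ∀ a → a ^ suc a ÷ suc a ^ suc a ≼ a ^ a ÷ suc a ^ a
  lower≼upper-diagonal a = cross (begin
    a * a ^ a * suc a ^ a        ≡⟨ regroup a (a ^ a) (suc a ^ a) ⟩
    a ^ a * suc a ^ a * a        ≤⟨ *-monoʳ-≤ (a ^ a * suc a ^ a) (n≤1+n a) ⟩
    a ^ a * suc a ^ a * suc a    ≡⟨ regroup′ (suc a) (a ^ a) (suc a ^ a) ⟩
    a ^ a * (suc a * suc a ^ a)  ∎)
    where
    open ≤-Reasoning
    regroup : ∀ a x y → a * x * y ≡ x * y * a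
    regroup = solve-∀
    regroup′ : ∀ a x y → x * y * a ≡ x * (a * y)
    regroup′ = solve-∀

  0<[1+x]^y : ∀ x y → 0 < suc x ^ y
  0<[1+x]^y x y = m^n>0 (suc x) y

  lower-increasing : ∀ a d → a ^ suc a ÷ suc a ^ suc a ≼ (d + a) ^ suc (d + a) ÷ suc (d + a) ^ suc (d + a)
  lower-increasing a zero    = cross ≤-refl
  lower-increasing a (suc d) = ≼-trans (0<[1+x]^y (d + a) (suc (d + a))) (lower-increasing a d) (lower-step (d + a))

  upper-decreasing : ∀ k d → (d + k) ^ (d + k) ÷ suc (d + k) ^ (d + k) ≼ k ^ k ÷ suc k ^ k
  upper-decreasing k zero    = cross ≤-refl
  upper-decreasing k (suc d) = ≼-trans (0<[1+x]^y (d + k) (d + k)) (upper-step (d + k)) (upper-decreasing k d)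

  lower≼upper : ∀ a k → a ^ suc a ÷ suc a ^ suc a ≼ k ^ k ÷ suc k ^ k
  lower≼upper a k with ≤-total a k
  ... | inj₁ a≤k = subst (λ z → a ^ suc a ÷ suc a ^ suc a ≼ z ^ z ÷ suc z ^ z) (m∸n+n≡m a≤k)
                     (≼-trans (0<[1+x]^y (k ∸ a + a) (suc (k ∸ a + a))) (lower-increasing a (k ∸ a)) (lower≼upper-diagonal (k ∸ a + a)))
  ... | inj₂ k≤a = subst (λ z → z ^ suc z ÷ suc z ^ suc z ≼ k ^ k ÷ suc k ^ k) (m∸n+n≡m k≤a)
                     (≼-trans (0<[1+x]^y (a ∸ k + k) (a ∸ k + k)) (lower≼upper-diagonal (a ∸ k + k)) (upper-decreasing k (a ∸ k)))

  lower≤upper : ∀ a k → a ^ suc a * suc k ^ k ≤ k ^ k * suc a ^ suc a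
  lower≤upper a k = uncross (lower≼upper a k)

open import Level using (0ℓ)
open import Function using (_∘_)
open import Data.Nat as ℕ using (ℕ; zero; suc; z≤n; s≤s)
import Data.Nat.Properties as ℕₚ
open import Data.Integer as ℤ using (+_)
import Data.Integer.Properties as ℤₚ
open import Data.Rational using (ℚ; 0ℚ; 1ℚ; _+_; _-_; -_; _*_; _≤_; _<_; _/_; toℚᵘ; positive; nonNegative)
open import Data.Rational.Properties
import Data.Rational.Unnormalised as ℚᵘ
import Data.Rational.Unnormalised.Properties as ℚᵘₚ
open import Data.Fin using (Fin; zero; suc; toℕ)
open import Data.Fin.Properties using (suc-injective; any?; all?; pigeonhole; toℕ<n) renaming (_≟_ to _≟ᶠ_)
open import Data.Maybe using (Maybe; just; nothing)
open import Data.Maybe.Properties using (≡-dec; just-injective)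
open import Data.Bool using (Bool; true; false; _∧_; not; if_then_else_)
import Data.Bool as Bool
open import Data.Bool.Properties using (∧-conicalˡ; ∧-conicalʳ; ∧-comm; ∧-zeroʳ; ∧-identityʳ; ¬-not)
open import Data.Product using (Σ; ∃; _×_; _,_; proj₁; proj₂)
open import Data.Sum using (_⊎_; inj₁; inj₂)
open import Data.Empty using (⊥-elim)
open import Relation.Nullary using (¬_; yes; no; Dec)
open import Relation.Nullary.Decidable using (isYes; isYes≗does; dec-true; dec-false; dec⇒maybe)
open import Relation.Unary using (Pred; Decidable)
open import Relation.Binary.PropositionalEquality
open import Relation.Binary.Definitions using (DecidableEquality)
open import Algebra using (CommutativeRing; Semiring)
import Algebra.Properties.CommutativeSemigroup as CommutativeSemigroupProperties
import Algebra.Properties.Semiring.Mult as SemiringMult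
import Algebra.Properties.Semiring.Sum as SemiringSum
open import Tactic.RingSolver using (solve-∀)
open import Tactic.RingSolver.Core.AlmostCommutativeRing using (AlmostCommutativeRing; fromCommutativeRing)

open import Defs
open PowerBounds using (pow-≥-linear)

private
  variable
    p q r : ℚ
    k l : ℕ
    X : Set

isYes-true : ∀ {a} {A : Set a} (a? : Dec A) → A → isYes a? ≡ true
isYes-true a? a = trans (isYes≗does a?) (dec-true a? a)

isYes-false : ∀ {a} {A : Set a} (a? : Dec A) → ¬ A → isYes a? ≡ false
isYes-false a? ¬a = trans (isYes≗does a?) (dec-false a? ¬a)

isYes-sound : ∀ {a} {A : Set a} (a? : Dec A) → isYes a? ≡ true → A
isYes-sound (yes a) _ = a

ℚ-ring : AlmostCommutativeRing 0ℓ 0ℓ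
ℚ-ring = fromCommutativeRing +-*-commutativeRing (λ x → dec⇒maybe (0ℚ ≟ x))

scaleˡ-≤ : 0ℚ ≤ r → p ≤ q → r * p ≤ r * q
scaleˡ-≤ {r} 0≤r = *-monoˡ-≤-nonNeg r {{nonNegative 0≤r}}

scaleʳ-≤ : 0ℚ ≤ r → p ≤ q → p * r ≤ q * r
scaleʳ-≤ {r} 0≤r = *-monoʳ-≤-nonNeg r {{nonNegative 0≤r}}

unscaleˡ-≤ : 0ℚ < r → r * p ≤ r * q → p ≤ q
unscaleˡ-≤ {r} 0<r = *-cancelˡ-≤-pos r {{positive 0<r}}

unscaleʳ-≤ : 0ℚ < r → p * r ≤ q * r → p ≤ q
unscaleʳ-≤ {r} 0<r = *-cancelʳ-≤-pos r {{positive 0<r}}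

0≤-* : 0ℚ ≤ p → 0ℚ ≤ q → 0ℚ ≤ p * q
0≤-* {p} {q} 0≤p 0≤q = subst (_≤ p * q) (*-zeroʳ p) (scaleˡ-≤ 0≤p 0≤q)

*-mono-≤-nonNeg : ∀ {s} → 0ℚ ≤ p → 0ℚ ≤ r → p ≤ q → r ≤ s → p * r ≤ q * s
*-mono-≤-nonNeg 0≤p 0≤r p≤q r≤s = ≤-trans (scaleʳ-≤ 0≤r p≤q) (scaleˡ-≤ (≤-trans 0≤p p≤q) r≤s)

p≤q⇒0≤q-p : p ≤ q → 0ℚ ≤ q - p
p≤q⇒0≤q-p {p} {q} p≤q = subst (_≤ q - p) (+-inverseʳ p) (+-monoˡ-≤ (- p) p≤q)

0≤q-p⇒p≤q : 0ℚ ≤ q - p → p ≤ q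
0≤q-p⇒p≤q {q} {p} 0≤q-p = subst₂ _≤_ (+-identityˡ p) (q-p+p q p) (+-monoˡ-≤ p 0≤q-p)
  where
  q-p+p : ∀ q p → q - p + p ≡ q
  q-p+p = solve-∀ ℚ-ring

p≤q⇒p-q≤0 : p ≤ q → p - q ≤ 0ℚ
p≤q⇒p-q≤0 {p} {q} p≤q = subst (p - q ≤_) (+-inverseʳ q) (+-monoˡ-≤ (- q) p≤q)

p-q≤0⇒p≤q : p - q ≤ 0ℚ → p ≤ q
p-q≤0⇒p≤q {p} {q} p-q≤0 = subst₂ _≤_ (p-q+q p q) (+-identityˡ q) (+-monoˡ-≤ q p-q≤0)
  where
  p-q+q : ∀ p q → p - q + q ≡ p
  p-q+q = solve-∀ ℚ-ring

≤-by-difference : q - p ≡ r → 0ℚ ≤ r → p ≤ q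
≤-by-difference q-p≡r 0≤r = 0≤q-p⇒p≤q (subst (0ℚ ≤_) (sym q-p≡r) 0≤r)

ℚ-semiring : Semiring 0ℓ 0ℓ
ℚ-semiring = CommutativeRing.semiring +-*-commutativeRing

open SemiringMult ℚ-semiring using (×-homo-+; ×1-homo-*) renaming (_×_ to _·_)

-- Opaque, so that unification never unfolds it and implicit arguments stay inferable.
opaque
  fromℕ : ℕ → ℚ
  fromℕ k = k · 1ℚ

  fromℕ-+ : ∀ a b → fromℕ (a ℕ.+ b) ≡ fromℕ a + fromℕ b
  fromℕ-+ a b = ×-homo-+ 1ℚ a b

  fromℕ-* : ∀ a b → fromℕ (a ℕ.* b) ≡ fromℕ a * fromℕ b
  fromℕ-* = ×1-homo-*

  fromℕ-0 : fromℕ 0 ≡ 0ℚ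
  fromℕ-0 = refl

  fromℕ-1 : fromℕ 1 ≡ 1ℚ
  fromℕ-1 = +-identityʳ 1ℚ

  fromℕ-nonNeg : ∀ k → 0ℚ ≤ fromℕ k
  fromℕ-nonNeg zero = ≤-refl
  fromℕ-nonNeg (suc k) = +-mono-≤ (<⇒≤ (positive⁻¹ 1ℚ)) (fromℕ-nonNeg k)

  fromℕ-pos : ∀ {k} → 0 ℕ.< k → 0ℚ < fromℕ k
  fromℕ-pos {suc k} _ = +-mono-<-≤ (positive⁻¹ 1ℚ) (fromℕ-nonNeg k)

  fromℕ≡/1 : ∀ k → fromℕ k ≡ + k / 1
  fromℕ≡/1 zero = refl
  fromℕ≡/1 (suc k) = toℚᵘ-injective (begin
    toℚᵘ (1ℚ + fromℕ k)                   ≈⟨ toℚᵘ-homo-+ 1ℚ (fromℕ k) ⟩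
    toℚᵘ 1ℚ ℚᵘ.+ toℚᵘ (fromℕ k)           ≈⟨ ℚᵘₚ.+-congʳ (toℚᵘ 1ℚ) (toℚᵘ-cong (fromℕ≡/1 k)) ⟩
    toℚᵘ 1ℚ ℚᵘ.+ toℚᵘ (+ k / 1)           ≈⟨ ℚᵘₚ.+-congʳ (toℚᵘ 1ℚ) (toℚᵘ-fromℚᵘ (ℚᵘ.mkℚᵘ (+ k) 0)) ⟩
    ℚᵘ.mkℚᵘ (+ 1) 0 ℚᵘ.+ ℚᵘ.mkℚᵘ (+ k) 0  ≈⟨ ℚᵘ.*≡* (cong (ℤ._* + 1) (sum-of-integers k)) ⟩
    ℚᵘ.mkℚᵘ (+ suc k) 0                   ≈⟨ toℚᵘ-fromℚᵘ (ℚᵘ.mkℚᵘ (+ suc k) 0) ⟨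
    toℚᵘ (+ suc k / 1)                    ∎)
    where
    open ℚᵘₚ.≃-Reasoning
    sum-of-integers : ∀ k → + 1 ℤ.* + 1 ℤ.+ + k ℤ.* + 1 ≡ + suc k
    sum-of-integers k = cong (ℤ._+_ (+ 1)) (ℤₚ.*-identityʳ (+ k))

fromℕ-^ : ∀ a k l → fromℕ (a ℕ.^ (k ℕ.+ l)) ≡ fromℕ (a ℕ.^ k) * fromℕ (a ℕ.^ l)
fromℕ-^ a k l = trans (cong fromℕ (ℕₚ.^-distribˡ-+-* a k l)) (fromℕ-* (a ℕ.^ k) (a ℕ.^ l))

fromℕ-∸ : ∀ {a b} → b ℕ.≤ a → fromℕ (a ℕ.∸ b) ≡ fromℕ a - fromℕ b
fromℕ-∸ {a} {b} b≤a = begin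
  fromℕ (a ℕ.∸ b)                     ≡⟨ add-sub (fromℕ b) (fromℕ (a ℕ.∸ b)) ⟨
  fromℕ b + fromℕ (a ℕ.∸ b) - fromℕ b  ≡⟨ cong (_- fromℕ b) (fromℕ-+ b (a ℕ.∸ b)) ⟨
  fromℕ (b ℕ.+ (a ℕ.∸ b)) - fromℕ b    ≡⟨ cong (λ c → fromℕ c - fromℕ b) (ℕₚ.m+[n∸m]≡n b≤a) ⟩
  fromℕ a - fromℕ b                    ∎
  where
  open ≡-Reasoning
  add-sub : ∀ x y → x + y - x ≡ y
  add-sub = solve-∀ ℚ-ring

fromℕ-mono-≤ : ∀ {a b} → a ℕ.≤ b → fromℕ a ≤ fromℕ b
fromℕ-mono-≤ {a} {b} a≤b = ≤-by-difference (sym (fromℕ-∸ a≤b)) (fromℕ-nonNeg (b ℕ.∸ a))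

fraction-*-denominator : ∀ a b → (+ a / suc b) * fromℕ (suc b) ≡ fromℕ a
fraction-*-denominator a b = toℚᵘ-injective (begin
  toℚᵘ (+ a / suc b * fromℕ (suc b))              ≈⟨ toℚᵘ-homo-* (+ a / suc b) (fromℕ (suc b)) ⟩
  toℚᵘ (+ a / suc b) ℚᵘ.* toℚᵘ (fromℕ (suc b))     ≈⟨ ℚᵘₚ.*-cong (toℚᵘ-fromℚᵘ (ℚᵘ.mkℚᵘ (+ a) b)) (toℚᵘ-cong (fromℕ≡/1 (suc b))) ⟩
  ℚᵘ.mkℚᵘ (+ a) b ℚᵘ.* toℚᵘ (+ suc b / 1)         ≈⟨ ℚᵘₚ.*-congˡ {ℚᵘ.mkℚᵘ (+ a) b} (toℚᵘ-fromℚᵘ (ℚᵘ.mkℚᵘ (+ suc b) 0)) ⟩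
  ℚᵘ.mkℚᵘ (+ a) b ℚᵘ.* ℚᵘ.mkℚᵘ (+ suc b) 0        ≈⟨ ℚᵘ.*≡* (cross a b) ⟩
  ℚᵘ.mkℚᵘ (+ a) 0                                 ≈⟨ toℚᵘ-fromℚᵘ (ℚᵘ.mkℚᵘ (+ a) 0) ⟨
  toℚᵘ (+ a / 1)                                  ≈⟨ toℚᵘ-cong (fromℕ≡/1 a) ⟨
  toℚᵘ (fromℕ a)                                  ∎)
  where
  open ℚᵘₚ.≃-Reasoning
  cross : ∀ a b → + a ℤ.* + suc b ℤ.* + 1 ≡ + a ℤ.* + (suc b ℕ.* 1)
  cross a b = trans (ℤₚ.*-identityʳ _) (cong (λ c → + a ℤ.* + c) (sym (ℕₚ.*-identityʳ (suc b))))

-- Division by a natural number; the value at 0 is junk.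
_÷ℕ_ : ℚ → ℕ → ℚ
q ÷ℕ zero  = 0ℚ
q ÷ℕ suc k = q * (+ 1 / suc k)

÷ℕ-*-cancel : ∀ q {d} → 0 ℕ.< d → q ÷ℕ d * fromℕ d ≡ q
÷ℕ-*-cancel q {suc k} _ = begin
  q * (+ 1 / suc k) * fromℕ (suc k)    ≡⟨ *-assoc q (+ 1 / suc k) (fromℕ (suc k)) ⟩
  q * (+ 1 / suc k * fromℕ (suc k))    ≡⟨ cong (q *_) (trans (fraction-*-denominator 1 k) fromℕ-1) ⟩
  q * 1ℚ                               ≡⟨ *-identityʳ q ⟩
  q                                    ∎
  where open ≡-Reasoning

*-^ℚ : ∀ (u : ℚ) s t → u * fromℕ s ≡ fromℕ t → ∀ j → (u ^ℚ j) * fromℕ (s ℕ.^ j) ≡ fromℕ (t ℕ.^ j)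
*-^ℚ u s t us≡t zero    = *-identityˡ (fromℕ 1)
*-^ℚ u s t us≡t (suc j) = begin
  u * u ^ℚ j * fromℕ (s ℕ.* s ℕ.^ j)            ≡⟨ cong (u * u ^ℚ j *_) (fromℕ-* s (s ℕ.^ j)) ⟩
  u * u ^ℚ j * (fromℕ s * fromℕ (s ℕ.^ j))      ≡⟨ interchange u (u ^ℚ j) (fromℕ s) (fromℕ (s ℕ.^ j)) ⟩
  u * fromℕ s * (u ^ℚ j * fromℕ (s ℕ.^ j))      ≡⟨ cong₂ _*_ us≡t (*-^ℚ u s t us≡t j) ⟩
  fromℕ t * fromℕ (t ℕ.^ j)                     ≡⟨ fromℕ-* t (t ℕ.^ j) ⟨
  fromℕ (t ℕ.* t ℕ.^ j)                         ∎
  where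
  open ≡-Reasoning
  interchange : ∀ a b c d → a * b * (c * d) ≡ a * c * (b * d)
  interchange = solve-∀ ℚ-ring

fromℕ-[1+x]^y-pos : ∀ x y → 0ℚ < fromℕ (suc x ℕ.^ y)
fromℕ-[1+x]^y-pos x y = fromℕ-pos (ℕₚ.m^n>0 (suc x) y)

-- (a/(a+1))^(a+1) ≤ (k/(k+1))^k, the rationals by which Defs approximates e⁻¹ from above.
lower≤upper : ∀ a k → fromℕ (a ℕ.^ suc a) ≤ ((+ k / suc k) ^ℚ k) * fromℕ (suc a ℕ.^ suc a)
lower≤upper a k = unscaleʳ-≤ (fromℕ-[1+x]^y-pos k k) (begin
  fromℕ (a ℕ.^ suc a) * fromℕ (suc k ℕ.^ k)        ≡⟨ fromℕ-* (a ℕ.^ suc a) (suc k ℕ.^ k) ⟨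
  fromℕ (a ℕ.^ suc a ℕ.* suc k ℕ.^ k)              ≤⟨ fromℕ-mono-≤ (PowerBounds.lower≤upper a k) ⟩
  fromℕ (k ℕ.^ k ℕ.* suc a ℕ.^ suc a)              ≡⟨ fromℕ-* (k ℕ.^ k) (suc a ℕ.^ suc a) ⟩
  fromℕ (k ℕ.^ k) * fromℕ (suc a ℕ.^ suc a)        ≡⟨ cong (_* fromℕ (suc a ℕ.^ suc a)) (*-^ℚ u (suc k) k (fraction-*-denominator k k) k) ⟨
  u ^ℚ k * fromℕ (suc k ℕ.^ k) * fromℕ (suc a ℕ.^ suc a) ≡⟨ xy∙z≈xz∙y (u ^ℚ k) (fromℕ (suc k ℕ.^ k)) (fromℕ (suc a ℕ.^ suc a)) ⟩
  u ^ℚ k * fromℕ (suc a ℕ.^ suc a) * fromℕ (suc k ℕ.^ k) ∎)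
  where
  open ≤-Reasoning
  u : ℚ
  u = + k / suc k
  xy∙z≈xz∙y : ∀ x y z → x * y * z ≡ x * z * y
  xy∙z≈xz∙y = solve-∀ ℚ-ring

module ℚΣ = SemiringSum ℚ-semiring
module ℕΣ = SemiringSum ℕₚ.+-*-semiring
module ℕ+ = CommutativeSemigroupProperties ℕₚ.+-commutativeSemigroup

sumℚ≡∑ : (f : Fin k → ℚ) → sumℚ f ≡ ℚΣ.sum f
sumℚ≡∑ {zero}  f = refl
sumℚ≡∑ {suc k} f = cong (_+_ (f zero)) (sumℚ≡∑ (f ∘ suc))

sumℚ-cong : {f g : Fin k → ℚ} → (∀ i → f i ≡ g i) → sumℚ f ≡ sumℚ g
sumℚ-cong {zero}  f≡g = refl
sumℚ-cong {suc k} f≡g = cong₂ _+_ (f≡g zero) (sumℚ-cong (f≡g ∘ suc))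

sumℚ-mono-≤ : {f g : Fin k → ℚ} → (∀ i → f i ≤ g i) → sumℚ f ≤ sumℚ g
sumℚ-mono-≤ {zero}  f≤g = ≤-refl
sumℚ-mono-≤ {suc k} f≤g = +-mono-≤ (f≤g zero) (sumℚ-mono-≤ (f≤g ∘ suc))

sumℚ-nonNeg : {f : Fin k → ℚ} → (∀ i → 0ℚ ≤ f i) → 0ℚ ≤ sumℚ f
sumℚ-nonNeg {zero}  0≤f = ≤-refl
sumℚ-nonNeg {suc k} 0≤f = +-mono-≤ (0≤f zero) (sumℚ-nonNeg (0≤f ∘ suc))

sumℚ-distrib-+ : (f g : Fin k → ℚ) → sumℚ (λ i → f i + g i) ≡ sumℚ f + sumℚ g
sumℚ-distrib-+ f g = begin
  sumℚ (λ i → f i + g i)      ≡⟨ sumℚ≡∑ (λ i → f i + g i) ⟩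
  ℚΣ.sum (λ i → f i + g i)    ≡⟨ ℚΣ.∑-distrib-+ f g ⟩
  ℚΣ.sum f + ℚΣ.sum g         ≡⟨ cong₂ _+_ (sumℚ≡∑ f) (sumℚ≡∑ g) ⟨
  sumℚ f + sumℚ g             ∎
  where open ≡-Reasoning

sumℚ-distrib-sub : (f g : Fin k → ℚ) → sumℚ (λ i → f i - g i) ≡ sumℚ f - sumℚ g
sumℚ-distrib-sub {zero}  f g = refl
sumℚ-distrib-sub {suc k} f g = trans (cong (_+_ (f zero - g zero)) (sumℚ-distrib-sub (f ∘ suc) (g ∘ suc)))
                                   (interchange (f zero) (g zero) (sumℚ (f ∘ suc)) (sumℚ (g ∘ suc)))
  where
  interchange : ∀ a b c d → a - b + (c - d) ≡ a + c - (b + d)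
  interchange = solve-∀ ℚ-ring

*-distribˡ-sumℚ : ∀ c (f : Fin k → ℚ) → c * sumℚ f ≡ sumℚ (λ i → c * f i)
*-distribˡ-sumℚ c f = begin
  c * sumℚ f                  ≡⟨ cong (c *_) (sumℚ≡∑ f) ⟩
  c * ℚΣ.sum f                ≡⟨ ℚΣ.*-distribˡ-sum c f ⟩
  ℚΣ.sum (λ i → c * f i)      ≡⟨ sumℚ≡∑ (λ i → c * f i) ⟨
  sumℚ (λ i → c * f i)        ∎
  where open ≡-Reasoning

sumℚ-comm : (f : Fin k → Fin l → ℚ) → sumℚ (λ i → sumℚ (f i)) ≡ sumℚ (λ j → sumℚ (λ i → f i j))
sumℚ-comm f = begin
  sumℚ (λ i → sumℚ (f i))                   ≡⟨ sumℚ≡∑ (λ i → sumℚ (f i)) ⟩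
  ℚΣ.sum (λ i → sumℚ (f i))                 ≡⟨ ℚΣ.sum-cong-≗ (λ i → sumℚ≡∑ (f i)) ⟩
  ℚΣ.sum (λ i → ℚΣ.sum (f i))               ≡⟨ ℚΣ.∑-comm f ⟩
  ℚΣ.sum (λ j → ℚΣ.sum (λ i → f i j))       ≡⟨ ℚΣ.sum-cong-≗ (λ j → sumℚ≡∑ (λ i → f i j)) ⟨
  ℚΣ.sum (λ j → sumℚ (λ i → f i j))         ≡⟨ sumℚ≡∑ (λ j → sumℚ (λ i → f i j)) ⟨
  sumℚ (λ j → sumℚ (λ i → f i j))           ∎
  where open ≡-Reasoning

sumℚ-empty : ∀ {k} (f : Fin k → ℚ) → k ≡ 0 → sumℚ f ≡ 0ℚ
sumℚ-empty f refl = refl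

sumℚ-zero : ∀ k → sumℚ {k} (λ _ → 0ℚ) ≡ 0ℚ
sumℚ-zero zero    = refl
sumℚ-zero (suc k) = cong (_+_ 0ℚ) (sumℚ-zero k)

sumℚ-indicator : ∀ (c : Fin k) x → sumℚ (λ b → if isYes (c ≟ᶠ b) then x else 0ℚ) ≡ x
sumℚ-indicator {suc k} zero x = trans (cong (_+_ x) (trans (sumℚ-cong off) (sumℚ-zero k))) (+-identityʳ x)
  where
  off : ∀ (b : Fin k) → (if isYes (zero ≟ᶠ suc b) then x else 0ℚ) ≡ 0ℚ
  off b = refl
sumℚ-indicator {suc k} (suc c) x = trans (+-identityˡ _) (trans (sumℚ-cong shift) (sumℚ-indicator c x))
  where
  shift : ∀ (b : Fin k) → (if isYes (suc c ≟ᶠ suc b) then x else 0ℚ) ≡ (if isYes (c ≟ᶠ b) then x else 0ℚ)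
  shift b with c ≟ᶠ b
  ... | yes _ = refl
  ... | no  _ = refl

sumℕ≡∑ : (f : Fin k → ℕ) → sumℕ f ≡ ℕΣ.sum f
sumℕ≡∑ {zero}  f = refl
sumℕ≡∑ {suc k} f = cong (f zero ℕ.+_) (sumℕ≡∑ (f ∘ suc))

fromℕ-sumℕ : (f : Fin k → ℕ) → fromℕ (sumℕ f) ≡ sumℚ (fromℕ ∘ f)
fromℕ-sumℕ {zero}  f = fromℕ-0
fromℕ-sumℕ {suc k} f = trans (fromℕ-+ (f zero) _) (cong (_+_ (fromℕ (f zero))) (fromℕ-sumℕ (f ∘ suc)))

sumℕ-cong : {f g : Fin k → ℕ} → (∀ i → f i ≡ g i) → sumℕ f ≡ sumℕ g
sumℕ-cong {zero}  f≡g = refl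
sumℕ-cong {suc k} f≡g = cong₂ ℕ._+_ (f≡g zero) (sumℕ-cong (f≡g ∘ suc))

sumℕ-mono-≤ : {f g : Fin k → ℕ} → (∀ i → f i ℕ.≤ g i) → sumℕ f ℕ.≤ sumℕ g
sumℕ-mono-≤ {zero}  f≤g = z≤n
sumℕ-mono-≤ {suc k} f≤g = ℕₚ.+-mono-≤ (f≤g zero) (sumℕ-mono-≤ (f≤g ∘ suc))

sumℕ-mono-< : {f g : Fin k → ℕ} → (∀ i → f i ℕ.≤ g i) → ∀ j → f j ℕ.< g j → sumℕ f ℕ.< sumℕ g
sumℕ-mono-< {suc k} f≤g zero    fj<gj = ℕₚ.+-mono-<-≤ fj<gj (sumℕ-mono-≤ (f≤g ∘ suc))
sumℕ-mono-< {suc k} f≤g (suc j) fj<gj = ℕₚ.+-mono-≤-< (f≤g zero) (sumℕ-mono-< (f≤g ∘ suc) j fj<gj)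

sumℕ-zero : ∀ k → sumℕ {k} (λ _ → 0) ≡ 0
sumℕ-zero zero    = refl
sumℕ-zero (suc k) = sumℕ-zero k

≤-sumℕ : (f : Fin k → ℕ) → ∀ i → f i ℕ.≤ sumℕ f
≤-sumℕ f zero    = ℕₚ.m≤m+n (f zero) _
≤-sumℕ f (suc i) = ℕₚ.≤-trans (≤-sumℕ (f ∘ suc) i) (ℕₚ.m≤n+m _ (f zero))

sumℕ-comm : (f : Fin k → Fin l → ℕ) → sumℕ (λ i → sumℕ (f i)) ≡ sumℕ (λ j → sumℕ (λ i → f i j))
sumℕ-comm f = begin
  sumℕ (λ i → sumℕ (f i))                   ≡⟨ sumℕ≡∑ (λ i → sumℕ (f i)) ⟩
  ℕΣ.sum (λ i → sumℕ (f i))                 ≡⟨ ℕΣ.sum-cong-≗ (λ i → sumℕ≡∑ (f i)) ⟩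
  ℕΣ.sum (λ i → ℕΣ.sum (f i))               ≡⟨ ℕΣ.∑-comm f ⟩
  ℕΣ.sum (λ j → ℕΣ.sum (λ i → f i j))       ≡⟨ ℕΣ.sum-cong-≗ (λ j → sumℕ≡∑ (λ i → f i j)) ⟨
  ℕΣ.sum (λ j → sumℕ (λ i → f i j))         ≡⟨ sumℕ≡∑ (λ j → sumℕ (λ i → f i j)) ⟨
  sumℕ (λ j → sumℕ (λ i → f i j))           ∎
  where open ≡-Reasoning

sumℕ-raise : (f g : Fin k → ℕ) (b : Fin k) → (∀ c → c ≢ b → g c ≡ f c) → f b ℕ.≤ g b →
             sumℕ g ≡ sumℕ f ℕ.+ (g b ℕ.∸ f b)
sumℕ-raise {suc k} f g zero g≡f fb≤gb = begin
  g zero ℕ.+ sumℕ (g ∘ suc)                          ≡⟨ cong₂ ℕ._+_ (sym (ℕₚ.m+[n∸m]≡n fb≤gb)) (sumℕ-cong (λ c → g≡f (suc c) λ ())) ⟩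
  f zero ℕ.+ (g zero ℕ.∸ f zero) ℕ.+ sumℕ (f ∘ suc)  ≡⟨ ℕ+.xy∙z≈xz∙y (f zero) (g zero ℕ.∸ f zero) (sumℕ (f ∘ suc)) ⟩
  sumℕ f ℕ.+ (g zero ℕ.∸ f zero)                     ∎
  where open ≡-Reasoning
sumℕ-raise {suc k} f g (suc b) g≡f fb≤gb = begin
  g zero ℕ.+ sumℕ (g ∘ suc)                          ≡⟨ cong₂ ℕ._+_ (g≡f zero λ ()) (sumℕ-raise (f ∘ suc) (g ∘ suc) b g≡f′ fb≤gb) ⟩
  f zero ℕ.+ (sumℕ (f ∘ suc) ℕ.+ (g (suc b) ℕ.∸ f (suc b))) ≡⟨ ℕₚ.+-assoc (f zero) _ _ ⟨
  sumℕ f ℕ.+ (g (suc b) ℕ.∸ f (suc b))               ∎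
  where
  open ≡-Reasoning
  g≡f′ : ∀ c → c ≢ b → g (suc c) ≡ f (suc c)
  g≡f′ c c≢b = g≡f (suc c) (c≢b ∘ suc-injective)

indicator : Bool → ℕ
indicator b = if b then 1 else 0

count≡sumℕ : (f : Fin k → Bool) → count f ≡ sumℕ (indicator ∘ f)
count≡sumℕ {zero}  f = refl
count≡sumℕ {suc k} f = cong (indicator (f zero) ℕ.+_) (count≡sumℕ (f ∘ suc))

count-cong : {f g : Fin k → Bool} → (∀ i → f i ≡ g i) → count f ≡ count g
count-cong {zero}  f≡g = refl
count-cong {suc k} f≡g = cong₂ ℕ._+_ (cong indicator (f≡g zero)) (count-cong (f≡g ∘ suc))

count-mono : {f g : Fin k → Bool} → (∀ i → f i ≡ true → g i ≡ true) → count f ℕ.≤ count g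
count-mono {zero} f⇒g = z≤n
count-mono {suc k} {f} {g} f⇒g with f zero in f0 | g zero in g0
... | true  | true  = s≤s (count-mono (f⇒g ∘ suc))
... | true  | false with () ← trans (sym (f⇒g zero f0)) g0
... | false | true  = ℕₚ.m≤n⇒m≤1+n (count-mono (f⇒g ∘ suc))
... | false | false = count-mono (f⇒g ∘ suc)

count-split : (f g : Fin k → Bool) → count f ≡ count (λ i → f i ∧ g i) ℕ.+ count (λ i → f i ∧ not (g i))
count-split {zero} f g = refl
count-split {suc k} f g with f zero | g zero | count-split (f ∘ suc) (g ∘ suc)
... | true  | true  | ih = cong suc ih
... | true  | false | ih = trans (cong suc ih) (sym (ℕₚ.+-suc _ _))
... | false | _     | ih = ih

count-≤ : (f : Fin k → Bool) → count f ℕ.≤ k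
count-≤ {zero}  f = z≤n
count-≤ {suc k} f with f zero
... | true  = s≤s (count-≤ (f ∘ suc))
... | false = ℕₚ.m≤n⇒m≤1+n (count-≤ (f ∘ suc))

count-true : ∀ k → count {k} (λ _ → true) ≡ k
count-true zero    = refl
count-true (suc k) = cong suc (count-true k)

count-false : {f : Fin k → Bool} → (∀ i → f i ≡ false) → count f ≡ 0
count-false {zero}  f≡false = refl
count-false {suc k} f≡false rewrite f≡false zero = count-false (f≡false ∘ suc)

count-pos : (f : Fin k → Bool) → ∀ i → f i ≡ true → 0 ℕ.< count f
count-pos f zero fi rewrite fi = s≤s z≤n
count-pos f (suc i) fi with f zero
... | true  = s≤s z≤n
... | false = count-pos (f ∘ suc) i fi

count-witness : (f : Fin k → Bool) → 0 ℕ.< count f → ∃ λ i → f i ≡ true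
count-witness {suc k} f 0<count with f zero in f0
... | true  = zero , f0
... | false with count-witness (f ∘ suc) 0<count
...   | i , fi = suc i , fi

without : (Fin k → Bool) → Fin k → Fin k → Bool
without f j i = f i ∧ not (isYes (i ≟ᶠ j))

without-suc : (f : Fin (suc k) → Bool) → ∀ j i → without f (suc j) (suc i) ≡ without (f ∘ suc) j i
without-suc f j i with i ≟ᶠ j
... | yes _ = refl
... | no  _ = refl

count-without : (f : Fin k → Bool) → ∀ j → f j ≡ true → count f ≡ suc (count (without f j))
count-without {suc k} f zero fj rewrite fj = cong suc (count-cong (λ i → sym (∧-true (f (suc i)))))
  where
  ∧-true : ∀ b → b ∧ true ≡ b
  ∧-true true  = refl
  ∧-true false = refl
count-without {suc k} f (suc j) fj with f zero
... | true  = cong suc (trans (count-without (f ∘ suc) j fj) (cong suc (count-cong (sym ∘ without-suc f j))))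
... | false = trans (count-without (f ∘ suc) j fj) (cong suc (count-cong (sym ∘ without-suc f j)))

count-mono-injective : ∀ {a b} (P : Fin a → Bool) (Q : Fin b → Bool) (R : Fin a → Fin b → Set) →
                       (∀ i → P i ≡ true → ∃ λ j → R i j × Q j ≡ true) →
                       (∀ i i′ j → R i j → R i′ j → i ≡ i′) →
                       count P ℕ.≤ count Q
count-mono-injective {zero} P Q R image injective = z≤n
count-mono-injective {suc a} P Q R image injective with P zero in P0
... | false = count-mono-injective (P ∘ suc) Q (R ∘ suc) (image ∘ suc) (λ i i′ j r r′ → suc-injective (injective (suc i) (suc i′) j r r′))
... | true with image zero P0
...   | j₀ , Rj₀ , Qj₀ = subst (suc (count (P ∘ suc)) ℕ.≤_) (sym (count-without Q j₀ Qj₀))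
          (s≤s (count-mono-injective (P ∘ suc) (without Q j₀) (R ∘ suc) image′
                  (λ i i′ j r r′ → suc-injective (injective (suc i) (suc i′) j r r′))))
  where
  image′ : ∀ i → P (suc i) ≡ true → ∃ λ j → R (suc i) j × without Q j₀ j ≡ true
  image′ i Pi with image (suc i) Pi
  ... | j , Rj , Qj with j ≟ᶠ j₀
  ...   | yes refl with () ← injective zero (suc i) j Rj₀ Rj
  ...   | no  j≢j₀ = j , Rj , cong₂ _∧_ Qj (cong not (isYes-false (j ≟ᶠ j₀) j≢j₀))

Maximum : Pred X _ → (X → ℚ) → Set
Maximum {X} P v = Σ X λ x → P x × (∀ y → P y → v y ≤ v x)

Empty : Pred X _ → Set
Empty {X} P = ∀ (x : X) → ¬ P x

maximum-∃ : ∀ {j} (P : Fin j → Pred X _) (v : X → ℚ) → (∀ c → Empty (P c) ⊎ Maximum (P c) v) →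
            Empty (λ x → ∃ λ c → P c x) ⊎ Maximum (λ x → ∃ λ c → P c x) v
maximum-∃ {j = zero} P v parts = inj₁ λ x → λ ()
maximum-∃ {j = suc j} P v parts with parts zero | maximum-∃ (P ∘ suc) v (parts ∘ suc)
... | inj₁ none₀ | inj₁ none = inj₁ λ { x (zero , p) → none₀ x p ; x (suc c , p) → none x (c , p) }
... | inj₁ none₀ | inj₂ (x , (c , p) , max) = inj₂ (x , (suc c , p) , λ { y (zero , q) → ⊥-elim (none₀ y q) ; y (suc c′ , q) → max y (c′ , q) })
... | inj₂ (x₀ , p₀ , max₀) | inj₁ none = inj₂ (x₀ , (zero , p₀) , λ { y (zero , q) → max₀ y q ; y (suc c , q) → ⊥-elim (none y (c , q)) })
... | inj₂ (x₀ , p₀ , max₀) | inj₂ (x , (c , p) , max) with ≤-total (v x) (v x₀)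
...   | inj₁ vx≤vx₀ = inj₂ (x₀ , (zero , p₀) , λ { y (zero , q) → max₀ y q ; y (suc c′ , q) → ≤-trans (max y (c′ , q)) vx≤vx₀ })
...   | inj₂ vx₀≤vx = inj₂ (x , (suc c , p) , λ { y (zero , q) → ≤-trans (max₀ y q) vx₀≤vx ; y (suc c′ , q) → max y (c′ , q) })

maximum-Fin : ∀ {m} (P : Pred (Fin m) _) → Decidable P → (v : Fin m → ℚ) → Empty P ⊎ Maximum P v
maximum-Fin P P? v with maximum-∃ (λ c b → P c × c ≡ b) v single
  where
  single : ∀ c → Empty (λ b → P c × c ≡ b) ⊎ Maximum (λ b → P c × c ≡ b) v
  single c with P? c
  ... | yes pc = inj₂ (c , (pc , refl) , λ { _ (_ , refl) → ≤-refl })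
  ... | no ¬pc = inj₁ λ { _ (pc , _) → ¬pc pc }
... | inj₁ none = inj₁ λ b pb → none b (b , pb , refl)
... | inj₂ (b , (_ , pc , refl) , max) = inj₂ (b , pc , λ b′ pb′ → max b′ (b′ , pb′ , refl))

module _ {A : Set} {l} (enum : Fin l → A) (enum-surjective : ∀ a → ∃ λ c → enum c ≡ a) where

  private
    cons : ∀ {k} → A → (Fin k → A) → Fin (suc k) → A
    cons a f zero    = a
    cons a f (suc i) = f i

    cons-cong : ∀ {k a} {f g : Fin k → A} → (∀ i → f i ≡ g i) → ∀ i → cons a f i ≡ cons a g i
    cons-cong f≗g zero    = refl
    cons-cong f≗g (suc i) = f≗g i

    cons-tail : ∀ {k a} {f : Fin (suc k) → A} → f zero ≡ a → ∀ i → f i ≡ cons a (f ∘ suc) i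
    cons-tail f0≡a zero    = f0≡a
    cons-tail f0≡a (suc i) = refl

  maximum-Π : ∀ k (P : Pred (Fin k → A) _) → Decidable P → (∀ {f g} → (∀ i → f i ≡ g i) → P f → P g) →
              (v : (Fin k → A) → ℚ) → (∀ {f g} → (∀ i → f i ≡ g i) → v f ≡ v g) →
              Empty P ⊎ Maximum P v
  maximum-Π zero P P? P-resp v v-resp with P? (λ ())
  ... | yes p = inj₂ ((λ ()) , p , λ g _ → ≤-reflexive (v-resp λ ()))
  ... | no ¬p = inj₁ λ g pg → ¬p (P-resp (λ ()) pg)
  maximum-Π (suc k) P P? P-resp v v-resp with maximum-∃ (λ c f → P f × f zero ≡ enum c) v with-head
    where
    with-head : ∀ c → Empty (λ f → P f × f zero ≡ enum c) ⊎ Maximum (λ f → P f × f zero ≡ enum c) v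
    with-head c with maximum-Π k (P ∘ cons (enum c)) (P? ∘ cons (enum c)) (P-resp ∘ cons-cong)
                              (v ∘ cons (enum c)) (v-resp ∘ cons-cong)
    ... | inj₁ none = inj₁ λ f (pf , f0) → none (f ∘ suc) (P-resp (cons-tail f0) pf)
    ... | inj₂ (g , pg , max) = inj₂ (cons (enum c) g , (pg , refl) ,
            λ f (pf , f0) → ≤-trans (≤-reflexive (v-resp (cons-tail f0))) (max (f ∘ suc) (P-resp (cons-tail f0) pf)))
  ... | inj₁ none = inj₁ λ f pf → let (c , ec) = enum-surjective (f zero) in none f (c , pf , sym ec)
  ... | inj₂ (f , (_ , pf , _) , max) = inj₂ (f , pf , λ g pg → let (c , ec) = enum-surjective (g zero) in max g (c , pg , sym ec))

assigned : ∀ {m} → Maybe (Fin m) → Bool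
assigned nothing  = false
assigned (just _) = true

module _ (P : SAP) where
  open SAP P

  isAt-just : ∀ x b → isAt P x b ≡ true → x ≡ just b
  isAt-just (just c) b isAt≡true with c ≟ᶠ b
  ... | yes refl = refl

  isAt-refl : ∀ b → isAt P (just b) b ≡ true
  isAt-refl b = isYes-true (b ≟ᶠ b) refl

  load-cong : ∀ {A A′} → (∀ i → A i ≡ A′ i) → ∀ b → load P A b ≡ load P A′ b
  load-cong A≗A′ b = count-cong (λ i → cong (λ x → isAt P x b) (A≗A′ i))

  profit-cong : ∀ {A A′} → (∀ i → A i ≡ A′ i) → profit P A ≡ profit P A′
  profit-cong A≗A′ = sumℚ-cong (λ i → cong (λ x → gain P x i) (A≗A′ i))

  gain-nonNeg : ∀ x i → 0ℚ ≤ gain P x i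
  gain-nonNeg nothing  i = ≤-refl
  gain-nonNeg (just b) i = p≥0 i b

  profit-nonNeg : ∀ A → 0ℚ ≤ profit P A
  profit-nonNeg A = sumℚ-nonNeg (λ i → gain-nonNeg (A i) i)

  count-isAt : (x : Maybe (Fin m)) → count (isAt P x) ≡ indicator (assigned x)
  count-isAt nothing  = count-false {m} (λ _ → refl)
  count-isAt (just c) = trans (count-without (isAt P (just c)) c (isAt-refl c)) (cong suc (count-false elsewhere))
    where
    elsewhere : ∀ b → without (isAt P (just c)) c b ≡ false
    elsewhere b with c ≟ᶠ b | b ≟ᶠ c
    ... | yes refl | yes _   = refl
    ... | yes refl | no b≢c = ⊥-elim (b≢c refl)
    ... | no _     | _       = refl

  total-load : ∀ A → sumℕ (load P A) ≡ count (assigned ∘ A)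
  total-load A = begin
    sumℕ (λ b → count (λ i → isAt P (A i) b))                 ≡⟨ sumℕ-cong (λ b → count≡sumℕ (λ i → isAt P (A i) b)) ⟩
    sumℕ (λ b → sumℕ (λ i → indicator (isAt P (A i) b)))      ≡⟨ sumℕ-comm (λ b i → indicator (isAt P (A i) b)) ⟩
    sumℕ (λ i → sumℕ (λ b → indicator (isAt P (A i) b)))      ≡⟨ sumℕ-cong (λ i → sym (count≡sumℕ (isAt P (A i)))) ⟩
    sumℕ (λ i → count (isAt P (A i)))                         ≡⟨ sumℕ-cong (λ i → count-isAt (A i)) ⟩
    sumℕ (λ i → indicator (assigned (A i)))                   ≡⟨ count≡sumℕ (assigned ∘ A) ⟨
    count (assigned ∘ A)                                      ∎
    where open ≡-Reasoning

  total-load-≤ : ∀ A → sumℕ (load P A) ℕ.≤ n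
  total-load-≤ A = subst (ℕ._≤ n) (sym (total-load A)) (count-≤ (assigned ∘ A))

  unassigned-exists : ∀ A → sumℕ (load P A) ℕ.< n → ∃ λ i → A i ≡ nothing
  unassigned-exists A total<n
    with count-witness (not ∘ assigned ∘ A) (ℕₚ.n≢0⇒n>0 λ none → ℕₚ.<⇒≢ total<n (none-unassigned⇒full none))
    where
    none-unassigned⇒full : count (not ∘ assigned ∘ A) ≡ 0 → sumℕ (load P A) ≡ n
    none-unassigned⇒full none = begin
      sumℕ (load P A)                                       ≡⟨ total-load A ⟩
      count (assigned ∘ A)                                  ≡⟨ ℕₚ.+-identityʳ _ ⟨
      count (assigned ∘ A) ℕ.+ 0                            ≡⟨ cong (count (assigned ∘ A) ℕ.+_) none ⟨
      count (assigned ∘ A) ℕ.+ count (not ∘ assigned ∘ A)   ≡⟨ count-split (λ _ → true) (assigned ∘ A) ⟨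
      count {n} (λ _ → true)                                ≡⟨ count-true n ⟩
      n                                                     ∎
      where open ≡-Reasoning
  ... | i , unassigned-i = i , unassigned (A i) unassigned-i
    where
    unassigned : ∀ x → not (assigned x) ≡ true → x ≡ nothing
    unassigned nothing _ = refl

  assign : Assignment P → Fin n → Fin m → Assignment P
  assign A i₀ b i = if isYes (i ≟ᶠ i₀) then just b else A i

  module _ (A : Assignment P) (i₀ : Fin n) (b : Fin m) (free : A i₀ ≡ nothing) where

    load-assign-here : load P (assign A i₀ b) b ≡ suc (load P A b)
    load-assign-here = trans (count-without _ i₀ assigned-here) (cong suc (count-cong elsewhere))
      where
      assigned-here : isAt P (assign A i₀ b i₀) b ≡ true
      assigned-here rewrite isYes-true (i₀ ≟ᶠ i₀) refl = isAt-refl b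
      elsewhere : ∀ i → without (λ i → isAt P (assign A i₀ b i) b) i₀ i ≡ isAt P (A i) b
      elsewhere i with i ≟ᶠ i₀
      ... | yes refl rewrite free = ∧-zeroʳ _
      ... | no _ = ∧-identityʳ _

    load-assign-elsewhere : ∀ c → c ≢ b → load P (assign A i₀ b) c ≡ load P A c
    load-assign-elsewhere c c≢b = count-cong unchanged
      where
      unchanged : ∀ i → isAt P (assign A i₀ b i) c ≡ isAt P (A i) c
      unchanged i with i ≟ᶠ i₀
      ... | yes refl rewrite free = isYes-false (b ≟ᶠ c) (c≢b ∘ sym)
      ... | no _ = refl

    total-load-assign : sumℕ (load P (assign A i₀ b)) ≡ sumℕ (load P A) ℕ.+ 1
    total-load-assign = trans (sumℕ-raise (load P A) (load P (assign A i₀ b)) b load-assign-elsewhere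
                                          (subst (load P A b ℕ.≤_) (sym load-assign-here) (ℕₚ.n≤1+n _)))
                              (cong (sumℕ (load P A) ℕ.+_) (trans (cong (ℕ._∸ load P A b) load-assign-here) (ℕₚ.m+n∸n≡m 1 (load P A b))))

    profit-assign : profit P A ≤ profit P (assign A i₀ b)
    profit-assign = sumℚ-mono-≤ gain-assign
      where
      gain-assign : ∀ i → gain P (A i) i ≤ gain P (assign A i₀ b i) i
      gain-assign i with i ≟ᶠ i₀
      ... | yes refl rewrite free = p≥0 i b
      ... | no _ = ≤-refl

  private
    extend-within : ∀ d (T : Selection P) A → (∀ b → load P A b ℕ.≤ T b) → cost P T ℕ.≤ n →
                    cost P T ℕ.≤ d ℕ.+ sumℕ (load P A) →
                    Σ (Assignment P) λ A′ → Realizes P T A′ × profit P A ≤ profit P A′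
    extend-within d T A A≤T T≤n T≤d+A with any? (λ b → load P A b ℕ.<? T b)
    ... | no full = A , (λ b → ℕₚ.≤-antisym (A≤T b) (ℕₚ.≮⇒≥ (λ lt → full (b , lt)))) , ≤-refl
    ... | yes (b , Ab<Tb) with d | sumℕ-mono-< A≤T b Ab<Tb
    ...   | zero  | A<T = ⊥-elim (ℕₚ.<-irrefl refl (ℕₚ.<-≤-trans A<T T≤d+A))
    ...   | suc d | A<T with unassigned-exists A (ℕₚ.<-≤-trans A<T T≤n)
    ...     | i₀ , free with extend-within d T (assign A i₀ b) A′≤T T≤n T≤d+A′
      where
      A′≤T : ∀ c → load P (assign A i₀ b) c ℕ.≤ T c
      A′≤T c with c ≟ᶠ b
      ... | yes refl = subst (ℕ._≤ T c) (sym (load-assign-here A i₀ b free)) Ab<Tb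
      ... | no c≢b   = subst (ℕ._≤ T c) (sym (load-assign-elsewhere A i₀ b free c c≢b)) (A≤T c)
      T≤d+A′ : cost P T ℕ.≤ d ℕ.+ sumℕ (load P (assign A i₀ b))
      T≤d+A′ = subst (cost P T ℕ.≤_)
                     (trans (sym (ℕₚ.+-suc d _)) (cong (d ℕ.+_) (trans (ℕₚ.+-comm 1 _) (sym (total-load-assign A i₀ b free)))))
                     T≤d+A
    ...       | A′ , realizes , A≤A′ = A′ , realizes , ≤-trans (profit-assign A i₀ b free) A≤A′

  extend : ∀ (T : Selection P) A → (∀ b → load P A b ℕ.≤ T b) → cost P T ℕ.≤ n →
           Σ (Assignment P) λ A′ → Realizes P T A′ × profit P A ≤ profit P A′
  extend T A A≤T T≤n = extend-within (cost P T) T A A≤T T≤n (ℕₚ.m≤m+n _ _)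

  profit-≤-optimal : ∀ A (T : Selection P) AT → (∀ b → load P A b ℕ.≤ T b) → cost P T ℕ.≤ n →
                     OptFor P T AT → profit P A ≤ profit P AT
  profit-≤-optimal A T AT A≤T T≤n (_ , AT-max) with extend T A A≤T T≤n
  ... | A′ , realizes , A≤A′ = ≤-trans A≤A′ (AT-max A′ realizes)

  optimal-exists : ∀ (S : Selection P) → cost P S ℕ.≤ n → Σ (Assignment P) (OptFor P S)
  optimal-exists S S≤n
    with maximum-Π enum enum-surjective n (Realizes P S) (λ A → all? (λ b → load P A b ℕ.≟ S b))
                   (λ A≗A′ realizes b → trans (sym (load-cong A≗A′ b)) (realizes b))
                   (profit P) profit-cong
    where
    enum : Fin (suc m) → Maybe (Fin m)
    enum zero    = nothing
    enum (suc b) = just b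
    enum-surjective : ∀ x → ∃ λ c → enum c ≡ x
    enum-surjective nothing  = zero , refl
    enum-surjective (just b) = suc b , refl
  ... | inj₂ (A , realizes , max) = A , realizes , max
  ... | inj₁ none with extend S (λ _ → nothing) (λ b → subst (ℕ._≤ S b) (sym (count-false {n} λ _ → refl)) z≤n) S≤n
  ...   | A , realizes , _ = ⊥-elim (none A realizes)

-- Matchings and chains

record MaximalMatching {a b} (C : Fin a → Fin b → Bool) : Set where
  field
    partner    : Fin a → Maybe (Fin b)
    compatible : ∀ i j → partner i ≡ just j → C i j ≡ true
    injective  : ∀ i i′ j → partner i ≡ just j → partner i′ ≡ just j → i ≡ i′
    maximal    : ∀ i j → C i j ≡ true → partner i ≡ nothing → ∃ λ i′ → partner i′ ≡ just j

maximalMatching : ∀ a b (C : Fin a → Fin b → Bool) → MaximalMatching C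
maximalMatching zero b C = record { partner = λ () ; compatible = λ () ; injective = λ () ; maximal = λ () }
maximalMatching (suc a) b C with any? free-for-zero
  where
  open MaximalMatching (maximalMatching a b (C ∘ suc))
  taken? : ∀ j → Dec (∃ λ i′ → partner i′ ≡ just j)
  taken? j = any? (λ i′ → ≡-dec _≟ᶠ_ (partner i′) (just j))
  free-for-zero : ∀ j → Dec (C zero j ≡ true × ¬ ∃ λ i′ → partner i′ ≡ just j)
  free-for-zero j with C zero j Bool.≟ true | taken? j
  ... | yes c | yes t = no λ (_ , ¬t) → ¬t t
  ... | yes c | no ¬t = yes (c , ¬t)
  ... | no ¬c | _     = no λ (c , _) → ¬c c
... | yes (j₀ , C0j₀ , free) = record { partner = partner′ ; compatible = compatible′ ; injective = injective′ ; maximal = maximal′ }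
  where
  open MaximalMatching (maximalMatching a b (C ∘ suc))
  partner′ : Fin (suc a) → Maybe (Fin b)
  partner′ zero    = just j₀
  partner′ (suc i) = partner i
  compatible′ : ∀ i j → partner′ i ≡ just j → C i j ≡ true
  compatible′ zero    j refl = C0j₀
  compatible′ (suc i) j p    = compatible i j p
  injective′ : ∀ i i′ j → partner′ i ≡ just j → partner′ i′ ≡ just j → i ≡ i′
  injective′ zero    zero     j p    p′   = refl
  injective′ zero    (suc i′) j refl p′   = ⊥-elim (free (i′ , p′))
  injective′ (suc i) zero     j p    refl = ⊥-elim (free (i , p))
  injective′ (suc i) (suc i′) j p    p′   = cong suc (injective i i′ j p p′)
  maximal′ : ∀ i j → C i j ≡ true → partner′ i ≡ nothing → ∃ λ i′ → partner′ i′ ≡ just j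
  maximal′ (suc i) j c p with maximal i j c p
  ... | i′ , p′ = suc i′ , p′
... | no none-free = record { partner = partner′ ; compatible = compatible′ ; injective = injective′ ; maximal = maximal′ }
  where
  open MaximalMatching (maximalMatching a b (C ∘ suc))
  partner′ : Fin (suc a) → Maybe (Fin b)
  partner′ zero    = nothing
  partner′ (suc i) = partner i
  compatible′ : ∀ i j → partner′ i ≡ just j → C i j ≡ true
  compatible′ (suc i) j p = compatible i j p
  injective′ : ∀ i i′ j → partner′ i ≡ just j → partner′ i′ ≡ just j → i ≡ i′
  injective′ (suc i) (suc i′) j p p′ = cong suc (injective i i′ j p p′)
  maximal′ : ∀ i j → C i j ≡ true → partner′ i ≡ nothing → ∃ λ i′ → partner′ i′ ≡ just j
  maximal′ zero j c _ with any? (λ i′ → ≡-dec _≟ᶠ_ (partner i′) (just j))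
  ... | yes (i′ , p′) = suc i′ , p′
  ... | no untaken    = ⊥-elim (none-free (j , c , untaken))
  maximal′ (suc i) j c p with maximal i j c p
  ... | i′ , p′ = suc i′ , p′

module ChainLabelling {n} (next : Fin n → Maybe (Fin n))
                      (next-injective : ∀ i i′ j → next i ≡ just j → next i′ ≡ just j → i ≡ i′) where

  private
    Continues : Fin n → Set
    Continues i = next i ≢ nothing

    advance : Fin n → Fin n
    advance i with next i
    ... | nothing = i
    ... | just j  = j

    advance-just : ∀ {i j} → next i ≡ just j → advance i ≡ j
    advance-just {i} p with next i
    advance-just refl | just _ = refl

    advance-nothing : ∀ {i} → next i ≡ nothing → advance i ≡ i
    advance-nothing {i} p with next i
    advance-nothing refl | nothing = refl

    continues-just : ∀ {i} → Continues i → ∃ λ j → next i ≡ just j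
    continues-just {i} c with next i
    ... | nothing = ⊥-elim (c refl)
    ... | just j  = j , refl

    walk : ℕ → Fin n → Fin n
    walk zero    i = i
    walk (suc k) i = advance (walk k i)

    walk-+ : ∀ k l i → walk (k ℕ.+ l) i ≡ walk k (walk l i)
    walk-+ zero    l i = refl
    walk-+ (suc k) l i = cong advance (walk-+ k l i)

    walk-end : ∀ k {i} → next i ≡ nothing → walk k i ≡ i
    walk-end zero    p = refl
    walk-end (suc k) p rewrite walk-end k p = advance-nothing p

    walk-stops : ∀ {k l} i → k ℕ.≤ l → next (walk k i) ≡ nothing → walk l i ≡ walk k i
    walk-stops {k} {l} i k≤l p = trans (cong (λ z → walk z i) (sym (ℕₚ.m∸n+n≡m k≤l)))
                                       (trans (walk-+ (l ℕ.∸ k) k i) (walk-end (l ℕ.∸ k) p))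

    walk-cancel : ∀ a d i → (∀ k → k ℕ.< a ℕ.+ d → Continues (walk k i)) → walk a i ≡ walk (a ℕ.+ d) i → i ≡ walk d i
    walk-cancel zero    d i _         eq = eq
    walk-cancel (suc a) d i continues eq
      with continues-just (continues a (ℕₚ.≤-trans (ℕₚ.n<1+n a) (ℕₚ.m≤m+n (suc a) d)))
         | continues-just (continues (a ℕ.+ d) (ℕₚ.n<1+n (a ℕ.+ d)))
    ... | j , p | j′ , p′ = walk-cancel a d i (λ k k< → continues k (ℕₚ.m<n⇒m<1+n k<))
                              (next-injective _ _ j p (subst (λ z → next (walk (a ℕ.+ d) i) ≡ just z) (sym j≡j′) p′))
      where
      j≡j′ : j ≡ j′
      j≡j′ = trans (sym (advance-just p)) (trans eq (advance-just p′))

    -- n + 1 points of a walk in Fin n repeat, and injectivity makes the repetition a cycle through i.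
    continues-forever : ∀ i → (∀ k → k ℕ.≤ n → Continues (walk k i)) → Continues (walk (suc n) i)
    continues-forever i continues with pigeonhole (ℕₚ.n<1+n n) (λ k → walk (toℕ k) i)
    ... | k₁ , k₂ , k₁<k₂ , eq = subst Continues (sym around) (continues (suc n ℕ.∸ d) (ℕₚ.∸-monoʳ-≤ (suc n) 1≤d))
      where
      d : ℕ
      d = toℕ k₂ ℕ.∸ toℕ k₁
      k₁+d : toℕ k₁ ℕ.+ d ≡ toℕ k₂
      k₁+d = trans (ℕₚ.+-comm (toℕ k₁) d) (ℕₚ.m∸n+n≡m (ℕₚ.<⇒≤ k₁<k₂))
      k₂≤n : toℕ k₂ ℕ.≤ n
      k₂≤n = ℕₚ.≤-pred (toℕ<n k₂)
      cycle : i ≡ walk d i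
      cycle = walk-cancel (toℕ k₁) d i
                (λ k k< → continues k (ℕₚ.≤-trans (ℕₚ.<⇒≤ k<) (subst (ℕ._≤ n) (sym k₁+d) k₂≤n)))
                (trans eq (cong (λ z → walk z i) (sym k₁+d)))
      1≤d : 1 ℕ.≤ d
      1≤d = ℕₚ.m<n⇒0<n∸m k₁<k₂
      d≤1+n : d ℕ.≤ suc n
      d≤1+n = ℕₚ.≤-trans (ℕₚ.m∸n≤m (toℕ k₂) (toℕ k₁)) (ℕₚ.m≤n⇒m≤1+n k₂≤n)
      around : walk (suc n) i ≡ walk (suc n ℕ.∸ d) i
      around = trans (cong (λ z → walk z i) (sym (ℕₚ.m∸n+n≡m d≤1+n)))
                     (trans (walk-+ (suc n ℕ.∸ d) d i) (cong (walk (suc n ℕ.∸ d)) (sym cycle)))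

  module _ {X : Set} (out : Fin n → Maybe X) where

    private
      labelAt : Fin n → Maybe X
      labelAt i with next i
      ... | nothing = out i
      ... | just _  = nothing

      labelAt-continues : ∀ {i} → Continues i → labelAt i ≡ nothing
      labelAt-continues {i} c with next i
      ... | nothing = ⊥-elim (c refl)
      ... | just _  = refl

      labelAt-end : ∀ {i} → next i ≡ nothing → labelAt i ≡ out i
      labelAt-end {i} p with next i
      labelAt-end refl | nothing = refl

    -- The label of i is out at the end of the chain through i, or nothing if that chain is a cycle.
    label : Fin n → Maybe X
    label i = labelAt (walk n i)

    label-end : ∀ {t} → next t ≡ nothing → label t ≡ out t
    label-end p = trans (cong labelAt (walk-end n p)) (labelAt-end p)

    label-next : ∀ {i j} → next i ≡ just j → label i ≡ label j
    label-next {i} {j} p = trans one-more-advance (cong labelAt walk-suc)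
      where
      walk-suc : walk (suc n) i ≡ walk n j
      walk-suc = trans (cong (λ z → walk z i) (ℕₚ.+-comm 1 n)) (trans (walk-+ n 1 i) (cong (walk n) (advance-just p)))
      one-more-advance : labelAt (walk n i) ≡ labelAt (walk (suc n) i)
      one-more-advance with ≡-dec _≟ᶠ_ (next (walk n i)) nothing
      ... | yes stops = cong labelAt (sym (advance-nothing stops))
      ... | no goes   = trans (labelAt-continues goes)
                              (sym (labelAt-continues (continues-forever i λ k k≤n stops →
                                      goes (subst (λ w → next w ≡ nothing) (sym (walk-stops i k≤n stops)) stops))))

-- Splitting the profit difference of two assignments along chains

module Decomposition (P : SAP) (A A′ : Assignment P) where
  open SAP P

  _≟ᴹ_ : DecidableEquality (Maybe (Fin m))
  _≟ᴹ_ = ≡-dec _≟ᶠ_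

  sameSeminar : Maybe (Fin m) → Maybe (Fin m) → Bool
  sameSeminar nothing  y = false
  sameSeminar (just c) y = isAt P y c

  sameSeminar-≡ : ∀ x y → sameSeminar x y ≡ true → y ≡ x
  sameSeminar-≡ (just c) y same = isAt-just P y c same

  -- Pair students moving into a seminar with distinct old students of that seminar; the pairs form chains.
  open MaximalMatching (maximalMatching n n (λ i j → sameSeminar (A′ i) (A j)))
  open ChainLabelling partner injective using (label; label-end; label-next)

  partner-≡ : ∀ {i j} → partner i ≡ just j → A j ≡ A′ i
  partner-≡ {i} {j} p = sameSeminar-≡ (A′ i) (A j) (compatible i j p)

  inChain : Maybe (Fin m) → Fin n → Bool
  inChain x i = isYes (label A′ i ≟ᴹ x)

  hybrid : Maybe (Fin m) → Assignment P
  hybrid x i = if inChain x i then A′ i else A i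

  surplus : Maybe (Fin m) → Fin m → ℕ
  surplus nothing  c = 0
  surplus (just b) c = if isYes (b ≟ᶠ c) then load P A′ c ℕ.∸ load P A c else 0

  private
    at at′ : Fin m → Fin n → Bool
    at  c i = isAt P (A i) c
    at′ c i = isAt P (A′ i) c

    matched : Fin n → Bool
    matched i = assigned (partner i)

    unmatched-ends-at : ∀ {c i} → at′ c i ≡ true → partner i ≡ nothing → label A′ i ≡ just c
    unmatched-ends-at {c} {i} at′ci unmatched = trans (label-end A′ unmatched) (isAt-just P (A′ i) c at′ci)

    -- If some student moves into c unmatched, maximality pairs every old student of c with a distinct newcomer to c.
    unmatched-≤-surplus : ∀ c → count (λ i → at′ c i ∧ not (matched i)) ℕ.≤ load P A′ c ℕ.∸ load P A c
    unmatched-≤-surplus c with any? (λ i → (at′ c i ∧ not (matched i)) Bool.≟ true)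
    ... | no none = subst (ℕ._≤ load P A′ c ℕ.∸ load P A c) (sym (count-false λ i → ¬-not (none ∘ (i ,_)))) z≤n
    ... | yes (i₀ , u₀) = subst (ℕ._≤ load P A′ c ℕ.∸ load P A c)
                                (trans (cong (ℕ._∸ count matched-at) (count-split (at′ c) matched))
                                       (ℕₚ.m+n∸m≡n (count matched-at) _))
                                (ℕₚ.∸-monoʳ-≤ (load P A′ c) old≤matched)
      where
      matched-at : Fin n → Bool
      matched-at i = at′ c i ∧ matched i
      old≤matched : load P A c ℕ.≤ count matched-at
      old≤matched = count-mono-injective (at c) matched-at (λ j i → partner i ≡ just j) taken
                      (λ j j′ i p p′ → just-injective (trans (sym p) p′))
        where
        taken : ∀ j → at c j ≡ true → ∃ λ i → partner i ≡ just j × matched-at i ≡ true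
        taken j atcj with maximal i₀ j same (unmatched _ (∧-conicalʳ _ _ u₀))
          where
          same : sameSeminar (A′ i₀) (A j) ≡ true
          same rewrite isAt-just P (A′ i₀) c (∧-conicalˡ _ _ u₀) = atcj
          unmatched : ∀ x → not (assigned x) ≡ true → x ≡ nothing
          unmatched nothing _ = refl
        ... | i , pi = i , pi , cong₂ _∧_ (subst (λ x → isAt P x c ≡ true) (partner-≡ pi) atcj) (cong assigned pi)

    unmatched-≤-surplus-of-chain : ∀ x c → count (λ i → (inChain x i ∧ at′ c i) ∧ not (matched i)) ℕ.≤ surplus x c
    unmatched-≤-surplus-of-chain x c with x ≟ᴹ just c
    ... | yes refl rewrite isYes-true (c ≟ᶠ c) refl = ℕₚ.≤-trans (count-mono forget-chain) (unmatched-≤-surplus c)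
      where
      forget-chain : ∀ i → ((inChain x i ∧ at′ c i) ∧ not (matched i)) ≡ true → (at′ c i ∧ not (matched i)) ≡ true
      forget-chain i u with inChain x i | at′ c i | matched i
      ... | true | true | false = refl
    ... | no x≢c = subst (ℕ._≤ surplus x c) (sym (count-false λ i → ¬-not (x≢c ∘ ends-at-c i))) z≤n
      where
      ends-at-c : ∀ i → ((inChain x i ∧ at′ c i) ∧ not (matched i)) ≡ true → x ≡ just c
      ends-at-c i u with inChain x i in chain | at′ c i in moves | partner i in pi
      ... | true | true | nothing = trans (sym (isYes-sound (label A′ i ≟ᴹ x) chain)) (unmatched-ends-at moves pi)

    matched-≤-old : ∀ x c → count (λ i → (inChain x i ∧ at′ c i) ∧ matched i) ℕ.≤ count (λ j → inChain x j ∧ at c j)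
    matched-≤-old x c = count-mono-injective _ _ (λ i j → partner i ≡ just j) partner-in-chain
                          (λ i i′ j p p′ → injective i i′ j p p′)
      where
      partner-in-chain : ∀ i → ((inChain x i ∧ at′ c i) ∧ matched i) ≡ true →
                         ∃ λ j → partner i ≡ just j × (inChain x j ∧ at c j) ≡ true
      partner-in-chain i u with inChain x i in chain | at′ c i in moves | partner i in pi
      ... | true | true | just j = j , refl , cong₂ _∧_ (trans (cong (λ l → isYes (l ≟ᴹ x)) (sym (label-next A′ pi))) chain)
                                                      (subst (λ y → isAt P y c ≡ true) (sym (partner-≡ pi)) moves)

  load-hybrid : ∀ x c → load P (hybrid x) c ℕ.≤ load P A c ℕ.+ surplus x c
  load-hybrid x c = begin
    load P (hybrid x) c                                          ≡⟨ count-split at-hybrid (inChain x) ⟩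
    count (λ i → at-hybrid i ∧ inChain x i) ℕ.+ stay             ≡⟨ cong₂ ℕ._+_ (count-cong moved) (count-cong stayed) ⟩
    count (λ i → inChain x i ∧ at′ c i) ℕ.+ stay′                ≡⟨ cong (ℕ._+ stay′) (count-split _ matched) ⟩
    (count matched-movers ℕ.+ count unmatched-movers) ℕ.+ stay′  ≤⟨ ℕₚ.+-monoˡ-≤ stay′ movers-bound ⟩
    (count (λ j → inChain x j ∧ at c j) ℕ.+ surplus x c) ℕ.+ stay′ ≡⟨ ℕ+.xy∙z≈xz∙y _ (surplus x c) stay′ ⟩
    (count (λ j → inChain x j ∧ at c j) ℕ.+ stay′) ℕ.+ surplus x c ≡⟨ cong (ℕ._+ surplus x c) old-split ⟨
    load P A c ℕ.+ surplus x c                                   ∎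
    where
    open ℕₚ.≤-Reasoning
    at-hybrid : Fin n → Bool
    at-hybrid i = isAt P (hybrid x i) c
    stay stay′ : ℕ
    stay  = count (λ i → at-hybrid i ∧ not (inChain x i))
    stay′ = count (λ i → not (inChain x i) ∧ at c i)
    matched-movers unmatched-movers : Fin n → Bool
    matched-movers i = (inChain x i ∧ at′ c i) ∧ matched i
    unmatched-movers i = (inChain x i ∧ at′ c i) ∧ not (matched i)
    movers-bound : count matched-movers ℕ.+ count unmatched-movers ℕ.≤ count (λ j → inChain x j ∧ at c j) ℕ.+ surplus x c
    movers-bound = ℕₚ.+-mono-≤ (matched-≤-old x c) (unmatched-≤-surplus-of-chain x c)
    moved : ∀ i → (at-hybrid i ∧ inChain x i) ≡ (inChain x i ∧ at′ c i)
    moved i with inChain x i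
    ... | true  = ∧-identityʳ _
    ... | false = ∧-zeroʳ _
    old-split : load P A c ≡ count (λ j → inChain x j ∧ at c j) ℕ.+ stay′
    old-split = trans (count-split (at c) (inChain x)) (cong₂ ℕ._+_ (count-cong λ i → ∧-comm (at c i) _) (count-cong λ i → ∧-comm (at c i) _))
    stayed : ∀ i → (at-hybrid i ∧ not (inChain x i)) ≡ (not (inChain x i) ∧ at c i)
    stayed i with inChain x i
    ... | true  = ∧-zeroʳ _
    ... | false = ∧-identityʳ _

  gainHybrid : Maybe (Fin m) → ℚ
  gainHybrid x = profit P (hybrid x) - profit P A

  private
    difference : Fin n → ℚ
    difference i = gain P (A′ i) i - gain P (A i) i

    restrict : Bool → ℚ → ℚ
    restrict t q = if t then q else 0ℚ

    gainHybrid-≡ : ∀ x → gainHybrid x ≡ sumℚ (λ i → restrict (inChain x i) (difference i))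
    gainHybrid-≡ x = trans (sym (sumℚ-distrib-sub (λ i → gain P (hybrid x i) i) (λ i → gain P (A i) i))) (sumℚ-cong pointwise)
      where
      pointwise : ∀ i → gain P (hybrid x i) i - gain P (A i) i ≡ restrict (inChain x i) (difference i)
      pointwise i with inChain x i
      ... | true  = refl
      ... | false = +-inverseʳ (gain P (A i) i)

    one-chain-each : ∀ i → sumℚ (λ b → restrict (inChain (just b) i) (difference i)) + restrict (inChain nothing i) (difference i)
                           ≡ difference i
    one-chain-each i with label A′ i
    ... | nothing = trans (cong (_+ difference i) (sumℚ-zero m)) (+-identityˡ _)
    ... | just c  = trans (+-identityʳ _) (trans (sumℚ-cong same-test) (sumℚ-indicator c (difference i)))
      where
      same-test : ∀ b → restrict (isYes (just c ≟ᴹ just b)) (difference i) ≡ restrict (isYes (c ≟ᶠ b)) (difference i)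
      same-test b with c ≟ᶠ b
      ... | yes _ = refl
      ... | no  _ = refl

  gainHybrid-decomposition : sumℚ (gainHybrid ∘ just) + gainHybrid nothing ≡ profit P A′ - profit P A
  gainHybrid-decomposition = begin
    sumℚ (gainHybrid ∘ just) + gainHybrid nothing
      ≡⟨ cong₂ _+_ (sumℚ-cong (gainHybrid-≡ ∘ just)) (gainHybrid-≡ nothing) ⟩
    sumℚ (λ b → sumℚ (λ i → part (just b) i)) + sumℚ (part nothing)
      ≡⟨ cong (_+ sumℚ (part nothing)) (sumℚ-comm (λ b i → part (just b) i)) ⟩
    sumℚ (λ i → sumℚ (λ b → part (just b) i)) + sumℚ (part nothing)
      ≡⟨ sumℚ-distrib-+ (λ i → sumℚ (λ b → part (just b) i)) (part nothing) ⟨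
    sumℚ (λ i → sumℚ (λ b → part (just b) i) + part nothing i)
      ≡⟨ sumℚ-cong one-chain-each ⟩
    sumℚ difference
      ≡⟨ sumℚ-distrib-sub (λ i → gain P (A′ i) i) (λ i → gain P (A i) i) ⟩
    profit P A′ - profit P A
      ∎
    where
    open ≡-Reasoning
    part : Maybe (Fin m) → Fin n → ℚ
    part x i = restrict (inChain x i) (difference i)

module GreedyState (P : SAP) (A* : Assignment P) (S : Selection P) (AS : Assignment P)
                   (AS-optimal : OptFor P S AS) (S≤n : cost P S ℕ.≤ SAP.n P) where
  open SAP P
  open Decomposition P AS A*

  shortfall : Fin m → ℕ
  shortfall b = load P A* b ℕ.∸ S b

  raise : Fin m → Selection P
  raise b c = if isYes (b ≟ᶠ c) then load P A* c else S c

  marginal : Fin m → ℚ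
  marginal = gainHybrid ∘ just

  total-shortfall-≤ : sumℕ shortfall ℕ.≤ n
  total-shortfall-≤ = ℕₚ.≤-trans (sumℕ-mono-≤ (λ b → ℕₚ.m∸n≤m (load P A* b) (S b))) (total-load-≤ P A*)

  private
    AS-loads : ∀ c → load P AS c ≡ S c
    AS-loads = proj₁ AS-optimal

    bump : Fin m → Fin m → ℕ
    bump b c = if isYes (b ≟ᶠ c) then shortfall b else 0

    bump-≢ : ∀ {b c} → b ≢ c → bump b c ≡ 0
    bump-≢ {b} {c} b≢c rewrite isYes-false (b ≟ᶠ c) b≢c = refl

    load-hybrid-≤ : ∀ b c → load P (hybrid (just b)) c ℕ.≤ S c ℕ.+ bump b c
    load-hybrid-≤ b c = subst (load P (hybrid (just b)) c ℕ.≤_) (cong₂ ℕ._+_ (AS-loads c) surplus≡bump) (load-hybrid (just b) c)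
      where
      surplus≡bump : surplus (just b) c ≡ bump b c
      surplus≡bump with b ≟ᶠ c
      ... | yes refl = cong (load P A* b ℕ.∸_) (AS-loads b)
      ... | no _     = refl

    ≤-AS : ∀ A → (∀ c → load P A c ℕ.≤ S c) → profit P A ≤ profit P AS
    ≤-AS A A≤S = profit-≤-optimal P A S AS A≤S S≤n AS-optimal

  gap-≤-total-marginal : profit P A* - profit P AS ≤ sumℚ marginal
  gap-≤-total-marginal = begin
    profit P A* - profit P AS              ≡⟨ gainHybrid-decomposition ⟨
    sumℚ marginal + gainHybrid nothing     ≤⟨ +-monoʳ-≤ (sumℚ marginal) (p≤q⇒p-q≤0 (≤-AS (hybrid nothing) stays-within-S)) ⟩
    sumℚ marginal + 0ℚ                     ≡⟨ +-identityʳ (sumℚ marginal) ⟩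
    sumℚ marginal                          ∎
    where
    open ≤-Reasoning
    stays-within-S : ∀ c → load P (hybrid nothing) c ℕ.≤ S c
    stays-within-S c = subst (load P (hybrid nothing) c ℕ.≤_) (trans (ℕₚ.+-identityʳ _) (AS-loads c)) (load-hybrid nothing c)

  marginal-≤-0 : ∀ b → shortfall b ≡ 0 → marginal b ≤ 0ℚ
  marginal-≤-0 b no-shortfall = p≤q⇒p-q≤0 (≤-AS (hybrid (just b)) within-S)
    where
    within-S : ∀ c → load P (hybrid (just b)) c ℕ.≤ S c
    within-S c = ℕₚ.≤-trans (load-hybrid-≤ b c) (ℕₚ.≤-reflexive (trans (cong (S c ℕ.+_) no-bump) (ℕₚ.+-identityʳ (S c))))
      where
      no-bump : bump b c ≡ 0
      no-bump with b ≟ᶠ c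
      ... | yes refl = no-shortfall
      ... | no _     = refl

  marginal-≤-raise : ∀ b → S b ℕ.≤ load P A* b → cost P (raise b) ℕ.≤ n → ∀ AT → OptFor P (raise b) AT →
                     marginal b ≤ profit P AT - profit P AS
  marginal-≤-raise b S≤A* raise≤n AT AT-optimal =
    +-monoˡ-≤ (- profit P AS) (profit-≤-optimal P (hybrid (just b)) (raise b) AT within-raise raise≤n AT-optimal)
    where
    within-raise : ∀ c → load P (hybrid (just b)) c ℕ.≤ raise b c
    within-raise c = ℕₚ.≤-trans (load-hybrid-≤ b c) (ℕₚ.≤-reflexive S+bump≡raise)
      where
      S+bump≡raise : S c ℕ.+ bump b c ≡ raise b c
      S+bump≡raise with b ≟ᶠ c
      ... | yes refl = ℕₚ.m+[n∸m]≡n S≤A*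
      ... | no _     = ℕₚ.+-identityʳ (S c)

  module _ (b : Fin m) where

    private

      moving : Fin n → Bool
      moving i = inChain (just b) i ∧ isAt P (A* i) b

      newcomers rest : Assignment P
      newcomers i = if moving i then just b else nothing
      rest      i = if moving i then nothing else hybrid (just b) i

      gain-split : ∀ i → gain P (hybrid (just b) i) i ≡ gain P (rest i) i + gain P (newcomers i) i
      gain-split i with inChain (just b) i | isAt P (A* i) b in at-b
      ... | true  | true  = trans (cong (λ x → gain P x i) (isAt-just P (A* i) b at-b)) (sym (+-identityˡ _))
      ... | true  | false = sym (+-identityʳ _)
      ... | false | _     = sym (+-identityʳ _)

      moving-hybrid : ∀ i → moving i ≡ true → hybrid (just b) i ≡ just b
      moving-hybrid i mv with inChain (just b) i
      ... | true = isAt-just P (A* i) b mv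

      rest-within-S : ∀ c → load P rest c ℕ.≤ S c
      rest-within-S c with b ≟ᶠ c
      ... | yes refl = subst (load P rest b ℕ.≤_) (AS-loads b) (count-mono rest-at-b)
        where
        rest-at-b : ∀ i → isAt P (rest i) b ≡ true → isAt P (AS i) b ≡ true
        rest-at-b i at-b with inChain (just b) i | isAt P (A* i) b in A*-at-b
        ... | false | _     = at-b
        ... | true  | false with () ← trans (sym at-b) A*-at-b
      ... | no b≢c = begin
        load P rest c                  ≡⟨ count-cong same-elsewhere ⟩
        load P (hybrid (just b)) c     ≤⟨ load-hybrid-≤ b c ⟩
        S c ℕ.+ bump b c               ≡⟨ cong (S c ℕ.+_) (bump-≢ b≢c) ⟩
        S c ℕ.+ 0                      ≡⟨ ℕₚ.+-identityʳ (S c) ⟩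
        S c                            ∎
        where
        open ℕₚ.≤-Reasoning
        same-elsewhere : ∀ i → isAt P (rest i) c ≡ isAt P (hybrid (just b) i) c
        same-elsewhere i with moving i in mv
        ... | false = refl
        ... | true  = sym (trans (cong (λ x → isAt P x c) (moving-hybrid i mv)) (isYes-false (b ≟ᶠ c) b≢c))

      onlyAt : Selection P
      onlyAt c = if isYes (b ≟ᶠ c) then load P A* c else 0

      onlyAt-≤ : ∀ c → onlyAt c ℕ.≤ load P A* c
      onlyAt-≤ c with b ≟ᶠ c
      ... | yes refl = ℕₚ.≤-refl
      ... | no _     = z≤n

      newcomers-within : ∀ c → load P newcomers c ℕ.≤ onlyAt c
      newcomers-within c with b ≟ᶠ c
      ... | yes refl = count-mono from-A*
        where
        from-A* : ∀ i → isAt P (newcomers i) b ≡ true → isAt P (A* i) b ≡ true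
        from-A* i at-b with inChain (just b) i | isAt P (A* i) b
        ... | true | true = refl
      ... | no b≢c = ℕₚ.≤-reflexive (count-false none)
        where
        none : ∀ i → isAt P (newcomers i) c ≡ false
        none i with moving i
        ... | true  = isYes-false (b ≟ᶠ c) b≢c
        ... | false = refl

    marginal-≤-singleSeminar : FeasibleAssignment P A* → ∀ A₂ → IsA2 P (S-empty P) A₂ → marginal b ≤ profit P A₂
    marginal-≤-singleSeminar A*-feasible A₂ (_ , _ , A₂-maximal)
      with extend P onlyAt newcomers newcomers-within (ℕₚ.≤-trans (sumℕ-mono-≤ onlyAt-≤) (total-load-≤ P A*))
    ... | Q , Q-realizes , newcomers≤Q = begin
      profit P (hybrid (just b)) - profit P AS  ≤⟨ ≤-by-difference rearrange (p≤q⇒0≤q-p (≤-AS rest rest-within-S)) ⟩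
      profit P newcomers                        ≤⟨ newcomers≤Q ⟩
      profit P Q                                ≤⟨ A₂-maximal Q Q-feasible Q-single ⟩
      profit P A₂                               ∎
      where
      open ≤-Reasoning
      rearrange : profit P newcomers - (profit P (hybrid (just b)) - profit P AS) ≡ profit P AS - profit P rest
      rearrange = trans (cong (λ h → profit P newcomers - (h - profit P AS))
                              (trans (sumℚ-cong gain-split) (sumℚ-distrib-+ (λ i → gain P (rest i) i) (λ i → gain P (newcomers i) i))))
                        (cancel (profit P newcomers) (profit P rest) (profit P AS))
        where
        cancel : ∀ q r s → q - (r + q - s) ≡ s - r
        cancel = solve-∀ ℚ-ring
      Q-feasible : FeasibleAssignment P Q
      Q-feasible c = subst (K c) (sym (Q-realizes c)) allowed
        where
        allowed : K c (onlyAt c)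
        allowed with b ≟ᶠ c
        ... | yes refl = A*-feasible c
        ... | no _     = K0 c
      Q-single : SingleSeminar P (S-empty P) Q
      Q-single = b , refl , only-b
        where
        only-b : ∀ i → Q i ≡ nothing ⊎ Q i ≡ just b
        only-b i with Q i in Qi
        ... | nothing = inj₁ refl
        ... | just c with c ≟ᶠ b
        ...   | yes refl = inj₂ refl
        ...   | no c≢b   = ⊥-elim (ℕₚ.<-irrefl (sym empty) (count-pos (λ i → isAt P (Q i) c) i at-c))
          where
          at-c : isAt P (Q i) c ≡ true
          at-c rewrite Qi = isAt-refl P c
          empty : load P Q c ≡ 0
          empty = trans (Q-realizes c) (cong (λ t → if t then load P A* c else 0) (isYes-false (b ≟ᶠ c) (c≢b ∘ sym)))

-- Geometric decay of the gap

-- x ≤ (1 - 1/(a+1))^C · O, cleared of denominators.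
GapBound : ℕ → ℕ → ℚ → ℚ → Set
GapBound a C x O = fromℕ (suc a ℕ.^ C) * x ≤ fromℕ (a ℕ.^ C) * O

module _ {a : ℕ} where

  private
    N : ℕ
    N = suc a

  gapBound-nonPos : ∀ C {x O} → x ≤ 0ℚ → 0ℚ ≤ O → GapBound a C x O
  gapBound-nonPos C {x} {O} x≤0 0≤O =
    ≤-trans (subst (fromℕ (N ℕ.^ C) * x ≤_) (*-zeroʳ (fromℕ (N ℕ.^ C))) (scaleˡ-≤ (fromℕ-nonNeg _) x≤0)) (0≤-* (fromℕ-nonNeg _) 0≤O)

  gapBound-antimono : ∀ C {x y O} → y ≤ x → GapBound a C x O → GapBound a C y O
  gapBound-antimono C y≤x bound = ≤-trans (scaleˡ-≤ (fromℕ-nonNeg _) y≤x) bound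

  gapBound-step : ∀ C c {x x′ O} → 0ℚ ≤ O → c ℕ.≤ N → fromℕ N * x′ ≤ x * fromℕ (N ℕ.∸ c) →
                  GapBound a C x O → GapBound a (C ℕ.+ c) x′ O
  gapBound-step C c {x} {x′} {O} 0≤O c≤N shrink bound with x′ ≤? 0ℚ
  ... | yes x′≤0 = gapBound-nonPos (C ℕ.+ c) x′≤0 0≤O
  ... | no  x′≰0 = unscaleʳ-≤ (fromℕ-pos (ℕ.s≤s ℕ.z≤n)) (begin
    fromℕ (N ℕ.^ (C ℕ.+ c)) * x′ * fromℕ N          ≡⟨ cong (λ z → z * x′ * fromℕ N) (fromℕ-^ N C c) ⟩
    NC * Nc * x′ * fromℕ N                          ≡⟨ regroup NC Nc x′ (fromℕ N) ⟩
    NC * Nc * (fromℕ N * x′)                        ≤⟨ scaleˡ-≤ (0≤-* (fromℕ-nonNeg _) (fromℕ-nonNeg _)) shrink ⟩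
    NC * Nc * (x * fromℕ (N ℕ.∸ c))                 ≡⟨ interchange NC Nc x (fromℕ (N ℕ.∸ c)) ⟩
    NC * x * (Nc * fromℕ (N ℕ.∸ c))                 ≡⟨ cong (NC * x *_) (fromℕ-* (N ℕ.^ c) (N ℕ.∸ c)) ⟨
    NC * x * fromℕ (N ℕ.^ c ℕ.* (N ℕ.∸ c))          ≤⟨ *-mono-≤-nonNeg (0≤-* (fromℕ-nonNeg _) 0≤x) (fromℕ-nonNeg _) bound decay ⟩
    fromℕ (a ℕ.^ C) * O * fromℕ (N ℕ.* a ℕ.^ c)     ≡⟨ cong (fromℕ (a ℕ.^ C) * O *_) (fromℕ-* N (a ℕ.^ c)) ⟩
    fromℕ (a ℕ.^ C) * O * (fromℕ N * fromℕ (a ℕ.^ c)) ≡⟨ regroup′ (fromℕ (a ℕ.^ C)) O (fromℕ N) (fromℕ (a ℕ.^ c)) ⟩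
    fromℕ (a ℕ.^ C) * fromℕ (a ℕ.^ c) * O * fromℕ N ≡⟨ cong (λ z → z * O * fromℕ N) (fromℕ-^ a C c) ⟨
    fromℕ (a ℕ.^ (C ℕ.+ c)) * O * fromℕ N          ∎)
    where
    open ≤-Reasoning
    NC Nc : ℚ
    NC = fromℕ (N ℕ.^ C)
    Nc = fromℕ (N ℕ.^ c)
    decay : fromℕ (N ℕ.^ c ℕ.* (N ℕ.∸ c)) ≤ fromℕ (N ℕ.* a ℕ.^ c)
    decay = fromℕ-mono-≤ (pow-≥-linear N c)
    0≤x : 0ℚ ≤ x
    0≤x with 0ℚ ≤? x
    ... | yes 0≤x = 0≤x
    ... | no  0≰x = ⊥-elim (x′≰0 (unscaleˡ-≤ (fromℕ-pos (ℕ.s≤s ℕ.z≤n)) (begin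
      fromℕ N * x′              ≤⟨ shrink ⟩
      x * fromℕ (N ℕ.∸ c)       ≤⟨ scaleʳ-≤ (fromℕ-nonNeg _) (<⇒≤ (≰⇒> 0≰x)) ⟩
      0ℚ * fromℕ (N ℕ.∸ c)      ≡⟨ *-zeroˡ (fromℕ (N ℕ.∸ c)) ⟩
      0ℚ                        ≡⟨ *-zeroʳ (fromℕ N) ⟨
      fromℕ N * 0ℚ              ∎)))
    regroup : ∀ p q u v → p * q * u * v ≡ p * q * (v * u)
    regroup = solve-∀ ℚ-ring
    interchange : ∀ p q u v → p * q * (u * v) ≡ p * u * (q * v)
    interchange = solve-∀ ℚ-ring
    regroup′ : ∀ p o u v → p * o * (u * v) ≡ p * v * o * u
    regroup′ = solve-∀ ℚ-ring

  gapBound-gain : ∀ C c {x g O} → 0ℚ ≤ O → c ℕ.≤ N → x * fromℕ c ≤ g * fromℕ N →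
                  GapBound a C x O → GapBound a (C ℕ.+ c) (x - g) O
  gapBound-gain C c {x} {g} 0≤O c≤N xc≤gN = gapBound-step C c 0≤O c≤N
    (≤-by-difference (trans (cong (λ z → x * z - fromℕ N * (x - g)) (fromℕ-∸ c≤N)) (expand x (fromℕ N) (fromℕ c) g))
                     (p≤q⇒0≤q-p xc≤gN))
    where
    expand : ∀ x n c g → x * (n - c) - n * (x - g) ≡ g * n - x * c
    expand = solve-∀ ℚ-ring

  gapBound-weaken : ∀ d {y O} → 0ℚ ≤ O → GapBound a (d ℕ.+ N) y O → GapBound a N y O
  gapBound-weaken d {y} {O} 0≤O bound = unscaleʳ-≤ (fromℕ-[1+x]^y-pos a d) (begin
    fromℕ (N ℕ.^ N) * y * fromℕ (N ℕ.^ d)               ≡⟨ regroup (fromℕ (N ℕ.^ N)) y (fromℕ (N ℕ.^ d)) ⟩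
    fromℕ (N ℕ.^ d) * fromℕ (N ℕ.^ N) * y               ≡⟨ cong (_* y) (fromℕ-^ N d N) ⟨
    fromℕ (N ℕ.^ (d ℕ.+ N)) * y                         ≤⟨ bound ⟩
    fromℕ (a ℕ.^ (d ℕ.+ N)) * O                         ≡⟨ cong (_* O) (fromℕ-^ a d N) ⟩
    fromℕ (a ℕ.^ d) * fromℕ (a ℕ.^ N) * O               ≤⟨ scaleʳ-≤ 0≤O (scaleʳ-≤ (fromℕ-nonNeg _) a^d≤N^d) ⟩
    fromℕ (N ℕ.^ d) * fromℕ (a ℕ.^ N) * O               ≡⟨ regroup′ (fromℕ (N ℕ.^ d)) (fromℕ (a ℕ.^ N)) O ⟩
    fromℕ (a ℕ.^ N) * O * fromℕ (N ℕ.^ d)               ∎)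
    where
    open ≤-Reasoning
    a^d≤N^d : fromℕ (a ℕ.^ d) ≤ fromℕ (N ℕ.^ d)
    a^d≤N^d = fromℕ-mono-≤ (ℕₚ.^-monoˡ-≤ d (ℕₚ.n≤1+n a))
    regroup : ∀ p y q → p * y * q ≡ q * p * y
    regroup = solve-∀ ℚ-ring
    regroup′ : ∀ q e o → q * e * o ≡ e * o * q
    regroup′ = solve-∀ ℚ-ring

  gapBound-approximation : ∀ {O T A} → 0ℚ ≤ O → GapBound a N (O - T) O → T ≤ A + A → AtLeastConstTimes A O
  gapBound-approximation {O} {T} {A} 0≤O bound T≤2A q (k , y<1-2q) = halve (begin
    (q + q) * O         ≤⟨ scaleʳ-≤ 0≤O (<⇒≤ 2q<1-y) ⟩
    (1ℚ - y) * O        ≤⟨ ≤-by-difference (rearrange T y O) (p≤q⇒0≤q-p gap≤yO) ⟩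
    T                   ≤⟨ T≤2A ⟩
    A + A               ∎)
    where
    open ≤-Reasoning
    y D : ℚ
    y = (+ k / suc k) ^ℚ k
    D = fromℕ (N ℕ.^ N)
    gap≤yO : O - T ≤ y * O
    gap≤yO = unscaleˡ-≤ (fromℕ-[1+x]^y-pos a N) (begin
      D * (O - T)                   ≤⟨ bound ⟩
      fromℕ (a ℕ.^ N) * O           ≤⟨ scaleʳ-≤ 0≤O (lower≤upper a k) ⟩
      y * D * O                     ≡⟨ swap y D O ⟩
      D * (y * O)                   ∎)
      where
      swap : ∀ y d o → y * d * o ≡ d * (y * o)
      swap = solve-∀ ℚ-ring
    2q<1-y : q + q < 1ℚ - y
    2q<1-y = subst₂ _<_ (cancel₁ y (q + q)) (cancel₂ y (q + q)) (+-monoˡ-< (q + q - y) y<1-2q)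
      where
      cancel₁ : ∀ y p → y + (p - y) ≡ p
      cancel₁ = solve-∀ ℚ-ring
      cancel₂ : ∀ y p → 1ℚ - p + (p - y) ≡ 1ℚ - y
      cancel₂ = solve-∀ ℚ-ring
    rearrange : ∀ t y o → t - (1ℚ - y) * o ≡ y * o - (o - t)
    rearrange = solve-∀ ℚ-ring
    halve : (q + q) * O ≤ A + A → q * O ≤ A
    halve 2qO≤2A with q * O ≤? A
    ... | yes qO≤A = qO≤A
    ... | no  qO≰A = ⊥-elim (<-irrefl refl (<-≤-trans (subst (A + A <_) (sym (*-distribʳ-+ O q q)) (+-mono-< (≰⇒> qO≰A) (≰⇒> qO≰A))) 2qO≤2A))

-- The greedy analysis

module _ (P : SAP) where
  open SAP P

  Inc-≤ : ∀ {S T} → Inc P S T → ∀ c → S c ℕ.≤ T c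
  Inc-≤ (_ , b , Sb<Tb , elsewhere) c with c ≟ᶠ b
  ... | yes refl = ℕₚ.<⇒≤ Sb<Tb
  ... | no c≢b   = ℕₚ.≤-reflexive (sym (elsewhere c c≢b))

  Inc-cost-≤ : ∀ {S T} → Inc P S T → cost P S ℕ.≤ cost P T
  Inc-cost-≤ S→T = sumℕ-mono-≤ (Inc-≤ S→T)

  Inc-profit-≤ : ∀ {S T} → Inc P S T → ∀ AS AT → OptFor P S AS → OptFor P T AT → profit P AS ≤ profit P AT
  Inc-profit-≤ {S} {T} S→T AS AT (AS-loads , _) AT-optimal =
    profit-≤-optimal P AS T AT (λ c → subst (ℕ._≤ T c) (sym (AS-loads c)) (Inc-≤ S→T c)) (proj₂ (proj₁ S→T)) AT-optimal

  GreedyRun-profit-≤ : ∀ {S F} → GreedyRun P S F → ∀ AS A₁ → OptFor P S AS → OptFor P F A₁ → profit P AS ≤ profit P A₁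
  GreedyRun-profit-≤ (stop _) AS A₁ (AS-loads , _) (_ , A₁-max) = A₁-max AS AS-loads
  GreedyRun-profit-≤ (step {S′} greedy run) AS A₁ AS-optimal A₁-optimal with optimal-exists P S′ (proj₂ (proj₁ (proj₁ greedy)))
  ... | AS′ , AS′-optimal = ≤-trans (Inc-profit-≤ (proj₁ greedy) AS AS′ AS-optimal AS′-optimal)
                                    (GreedyRun-profit-≤ run AS′ A₁ AS′-optimal A₁-optimal)

  cost-S-empty : cost P (S-empty P) ≡ 0
  cost-S-empty = sumℕ-zero m

  GreedyRun-isSelection : ∀ {S F} → GreedyRun P S F → IsSelection P S → IsSelection P F
  GreedyRun-isSelection (stop _)         S-selection = S-selection
  GreedyRun-isSelection (step greedy run) _          = GreedyRun-isSelection run (proj₁ (proj₁ (proj₁ greedy)))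

module Analysis (P : SAP) (A* : Assignment P) (A*-feasible : FeasibleAssignment P A*)
                (A₂ : Assignment P) (A₂-best : IsA2 P (S-empty P) A₂) (a : ℕ) (n≡1+a : SAP.n P ≡ suc a) where
  open SAP P

  Opt : ℚ
  Opt = profit P A*

  0≤Opt : 0ℚ ≤ Opt
  0≤Opt = profit-nonNeg P A*

  GapAt : Selection P → Assignment P → Set
  GapAt S AS = GapBound a (cost P S) (Opt - profit P AS) Opt

  Finished : Assignment P → Set
  Finished A = GapBound a (suc a) (Opt - (profit P A + profit P A₂)) Opt

  Progress : Selection P → Set
  Progress S = (∃ λ T → Inc P S T) × (∀ S′ → GreedyStep P S S′ → ∀ AS′ → OptFor P S′ AS′ → GapAt S′ AS′)

  covered⇒finished : ∀ A → Opt ≤ profit P A → Finished A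
  covered⇒finished A Opt≤A = gapBound-nonPos (suc a) (≤-by-difference (rearrange Opt (profit P A) (profit P A₂)) 0≤slack) 0≤Opt
    where
    rearrange : ∀ o s t → 0ℚ - (o - (s + t)) ≡ (s - o) + t
    rearrange = solve-∀ ℚ-ring
    0≤slack : 0ℚ ≤ (profit P A - Opt) + profit P A₂
    0≤slack = +-mono-≤ (p≤q⇒0≤q-p Opt≤A) (profit-nonNeg P A₂)

  module Round (S : Selection P) (AS : Assignment P) (AS-optimal : OptFor P S AS)
               (S-feasible : FeasibleSelection P S) (gap : GapAt S AS) where
    open GreedyState P A* S AS AS-optimal (proj₂ S-feasible)

    private
      x : ℚ
      x = Opt - profit P AS

      N : ℕ
      N = suc a

      ratio : Fin m → ℚ
      ratio b = marginal b ÷ℕ shortfall b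

      gap-nonPos⇒finished : x ≤ 0ℚ → Finished AS
      gap-nonPos⇒finished x≤0 = covered⇒finished AS (p-q≤0⇒p≤q x≤0)

      total-shortfall-≤-N : sumℕ shortfall ℕ.≤ N
      total-shortfall-≤-N = subst (sumℕ shortfall ℕ.≤_) n≡1+a total-shortfall-≤

    module AtBest (b₀ : Fin m) (0<δ₀ : 0 ℕ.< shortfall b₀) (best : ∀ b → 0 ℕ.< shortfall b → ratio b ≤ ratio b₀) where

      private
        δ₀≤N : shortfall b₀ ℕ.≤ N
        δ₀≤N = ℕₚ.≤-trans (≤-sumℕ shortfall b₀) total-shortfall-≤-N

        r₀ : ℚ
        r₀ = ratio b₀

        δ₀ : ℕ
        δ₀ = shortfall b₀

        marginal₀≡ : marginal b₀ ≡ r₀ * fromℕ δ₀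
        marginal₀≡ = sym (÷ℕ-*-cancel (marginal b₀) 0<δ₀)

        marginal-≤ : ∀ b → marginal b ≤ r₀ * fromℕ (shortfall b)
        marginal-≤ b with 0 ℕ.<? shortfall b
        ... | yes 0<δ = subst (_≤ r₀ * fromℕ (shortfall b)) (÷ℕ-*-cancel (marginal b) 0<δ) (scaleʳ-≤ (fromℕ-nonNeg _) (best b 0<δ))
        ... | no  0≮δ = begin
          marginal b                   ≤⟨ marginal-≤-0 b δ≡0 ⟩
          0ℚ                           ≡⟨ *-zeroʳ r₀ ⟨
          r₀ * 0ℚ                      ≡⟨ cong (r₀ *_) (trans (cong fromℕ δ≡0) fromℕ-0) ⟨
          r₀ * fromℕ (shortfall b)     ∎
          where
          open ≤-Reasoning
          δ≡0 : shortfall b ≡ 0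
          δ≡0 = ℕₚ.n≤0⇒n≡0 (ℕₚ.≮⇒≥ 0≮δ)

        gap-≤ : x ≤ r₀ * fromℕ (sumℕ shortfall)
        gap-≤ = begin
          x                                        ≤⟨ gap-≤-total-marginal ⟩
          sumℚ marginal                            ≤⟨ sumℚ-mono-≤ marginal-≤ ⟩
          sumℚ (λ b → r₀ * fromℕ (shortfall b))     ≡⟨ *-distribˡ-sumℚ r₀ (fromℕ ∘ shortfall) ⟨
          r₀ * sumℚ (fromℕ ∘ shortfall)            ≡⟨ cong (r₀ *_) (fromℕ-sumℕ shortfall) ⟨
          r₀ * fromℕ (sumℕ shortfall)              ∎
          where open ≤-Reasoning

      negative⇒finished : ¬ (0ℚ ≤ r₀) → Finished AS
      negative⇒finished 0≰r₀ = gap-nonPos⇒finished (begin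
        x                                  ≤⟨ gap-≤ ⟩
        r₀ * fromℕ (sumℕ shortfall)        ≤⟨ scaleʳ-≤ (fromℕ-nonNeg _) (<⇒≤ (≰⇒> 0≰r₀)) ⟩
        0ℚ * fromℕ (sumℕ shortfall)        ≡⟨ *-zeroˡ (fromℕ (sumℕ shortfall)) ⟩
        0ℚ                                 ∎)
        where open ≤-Reasoning

      module _ (0≤r₀ : 0ℚ ≤ r₀) where

        private
          gap-≤-N : x ≤ r₀ * fromℕ N
          gap-≤-N = ≤-trans gap-≤ (scaleˡ-≤ 0≤r₀ (fromℕ-mono-≤ total-shortfall-≤-N))

          gap-rate : ∀ {c g} → r₀ * fromℕ c ≤ g → x * fromℕ c ≤ g * fromℕ N
          gap-rate {c} {g} r₀c≤g = begin
            x * fromℕ c                  ≤⟨ scaleʳ-≤ (fromℕ-nonNeg c) gap-≤-N ⟩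
            r₀ * fromℕ N * fromℕ c       ≡⟨ xy∙z≈xz∙y r₀ (fromℕ N) (fromℕ c) ⟩
            r₀ * fromℕ c * fromℕ N       ≤⟨ scaleʳ-≤ (fromℕ-nonNeg N) r₀c≤g ⟩
            g * fromℕ N                  ∎
            where
            open ≤-Reasoning
            xy∙z≈xz∙y : ∀ x y z → x * y * z ≡ x * z * y
            xy∙z≈xz∙y = solve-∀ ℚ-ring

        overflow⇒finished : ¬ (cost P S ℕ.+ δ₀ ℕ.≤ n) → Finished AS
        overflow⇒finished overflow =
          gapBound-antimono N (≤-by-difference (rearrange Opt (profit P AS) (profit P A₂) (marginal b₀))
                                               (p≤q⇒0≤q-p (marginal-≤-singleSeminar b₀ A*-feasible A₂ A₂-best)))
            (gapBound-weaken (cost P S ℕ.+ δ₀ ℕ.∸ N) 0≤Opt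
              (subst (λ C → GapBound a C (x - marginal b₀) Opt) (sym (ℕₚ.m∸n+n≡m N≤)) shrunk))
          where
          rearrange : ∀ o s t m → o - s - m - (o - (s + t)) ≡ t - m
          rearrange = solve-∀ ℚ-ring
          N≤ : N ℕ.≤ cost P S ℕ.+ δ₀
          N≤ = subst (ℕ._≤ cost P S ℕ.+ δ₀) n≡1+a (ℕₚ.<⇒≤ (ℕₚ.≰⇒> overflow))
          shrunk : GapBound a (cost P S ℕ.+ δ₀) (x - marginal b₀) Opt
          shrunk = gapBound-gain (cost P S) δ₀ 0≤Opt δ₀≤N (gap-rate (≤-reflexive (sym marginal₀≡))) gap

        private
          T : Selection P
          T = raise b₀

          T-at-b₀ : T b₀ ≡ load P A* b₀
          T-at-b₀ = cong (if_then load P A* b₀ else S b₀) (isYes-true (b₀ ≟ᶠ b₀) refl)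

          T-elsewhere : ∀ c → c ≢ b₀ → T c ≡ S c
          T-elsewhere c c≢b₀ = cong (if_then load P A* c else S c) (isYes-false (b₀ ≟ᶠ c) (c≢b₀ ∘ sym))

          S<T : S b₀ ℕ.< T b₀
          S<T = subst (S b₀ ℕ.<_) (sym T-at-b₀) (ℕₚ.≰⇒> λ A*≤S → ℕₚ.<⇒≢ 0<δ₀ (sym (ℕₚ.m≤n⇒m∸n≡0 A*≤S)))

          cost-T : cost P T ≡ cost P S ℕ.+ δ₀
          cost-T = trans (sumℕ-raise S T b₀ T-elsewhere (ℕₚ.<⇒≤ S<T)) (cong (λ t → cost P S ℕ.+ (t ℕ.∸ S b₀)) T-at-b₀)

          cost-T∸cost-S : cost P T ℕ.∸ cost P S ≡ δ₀
          cost-T∸cost-S = trans (cong (ℕ._∸ cost P S) cost-T) (ℕₚ.m+n∸m≡n (cost P S) δ₀)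

          T-selection : IsSelection P T
          T-selection c with b₀ ≟ᶠ c
          ... | yes refl = A*-feasible c
          ... | no _     = proj₁ S-feasible c

        -- Raising b₀ is a candidate for GREEDY, so its chosen step gains at rate at least r₀ ≥ x / n.
        fits⇒progress : cost P S ℕ.+ δ₀ ℕ.≤ n → Progress S
        fits⇒progress fits = (T , T∈inc) , next
          where
          T≤n : cost P T ℕ.≤ n
          T≤n = subst (ℕ._≤ n) (sym cost-T) fits
          T∈inc : Inc P S T
          T∈inc = (T-selection , T≤n) , b₀ , S<T , T-elsewhere
          next : ∀ S′ → GreedyStep P S S′ → ∀ AS′ → OptFor P S′ AS′ → GapAt S′ AS′
          next S′ (S→S′ , greedy-choice) AS′ AS′-optimal with optimal-exists P T T≤n
          ... | AT , AT-optimal = subst₂ (λ C y → GapBound a C y Opt)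
                                         (ℕₚ.m+[n∸m]≡n (Inc-cost-≤ P S→S′)) (gained Opt (profit P AS) (profit P AS′))
                                         (gapBound-gain (cost P S) c 0≤Opt c≤N (gap-rate r₀c≤g) gap)
            where
            S≤A* : S b₀ ℕ.≤ load P A* b₀
            S≤A* = ℕₚ.<⇒≤ (subst (S b₀ ℕ.<_) T-at-b₀ S<T)
            c : ℕ
            c = cost P S′ ℕ.∸ cost P S
            g : ℚ
            g = profit P AS′ - profit P AS
            c≤N : c ℕ.≤ N
            c≤N = ℕₚ.≤-trans (ℕₚ.m∸n≤m (cost P S′) (cost P S)) (subst (cost P S′ ℕ.≤_) n≡1+a (proj₂ (proj₁ S→S′)))
            T-rate : (profit P AT - profit P AS) * fromℕ c ≤ g * fromℕ δ₀
            T-rate = subst₂ (λ u v → (profit P AT - profit P AS) * u ≤ g * v)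
                            (sym (fromℕ≡/1 c))
                            (trans (sym (fromℕ≡/1 (cost P T ℕ.∸ cost P S))) (cong fromℕ cost-T∸cost-S))
                            (greedy-choice T T∈inc AS AT AS′ AS-optimal AT-optimal AS′-optimal)
            r₀c≤g : r₀ * fromℕ c ≤ g
            r₀c≤g = unscaleʳ-≤ (fromℕ-pos 0<δ₀) (begin
              r₀ * fromℕ c * fromℕ δ₀            ≡⟨ xy∙z≈xz∙y r₀ (fromℕ c) (fromℕ δ₀) ⟩
              r₀ * fromℕ δ₀ * fromℕ c            ≡⟨ cong (_* fromℕ c) marginal₀≡ ⟨
              marginal b₀ * fromℕ c              ≤⟨ scaleʳ-≤ (fromℕ-nonNeg c) (marginal-≤-raise b₀ S≤A* T≤n AT AT-optimal) ⟩
              (profit P AT - profit P AS) * fromℕ c ≤⟨ T-rate ⟩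
              g * fromℕ δ₀                       ∎)
              where
              open ≤-Reasoning
              xy∙z≈xz∙y : ∀ x y z → x * y * z ≡ x * z * y
              xy∙z≈xz∙y = solve-∀ ℚ-ring
            gained : ∀ o s s′ → o - s - (s′ - s) ≡ o - s′
            gained = solve-∀ ℚ-ring

      round : Finished AS ⊎ Progress S
      round with 0ℚ ≤? r₀
      ... | no 0≰r₀ = inj₁ (negative⇒finished 0≰r₀)
      ... | yes 0≤r₀ with cost P S ℕ.+ δ₀ ℕ.≤? n
      ...   | yes fits     = inj₂ (fits⇒progress 0≤r₀ fits)
      ...   | no overflow  = inj₁ (overflow⇒finished 0≤r₀ overflow)

    round : Finished AS ⊎ Progress S
    round with maximum-Fin (λ b → 0 ℕ.< shortfall b) (λ b → 0 ℕ.<? shortfall b) ratio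
    ... | inj₂ (b₀ , 0<δ₀ , best) = AtBest.round b₀ 0<δ₀ best
    ... | inj₁ no-shortfall = inj₁ (covered⇒finished AS (profit-≤-optimal P A* S AS A*≤S (proj₂ S-feasible) AS-optimal))
      where
      A*≤S : ∀ b → load P A* b ℕ.≤ S b
      A*≤S b = ℕₚ.m∸n≡0⇒m≤n (ℕₚ.n≤0⇒n≡0 (ℕₚ.≮⇒≥ (no-shortfall b)))

  finished-along : ∀ {S F} → GreedyRun P S F → ∀ AS → OptFor P S AS → FeasibleSelection P S → GapAt S AS →
                   ∀ A₁ → OptFor P F A₁ → Finished A₁
  finished-along {S} run AS AS-optimal S-feasible gap A₁ A₁-optimal with Round.round S AS AS-optimal S-feasible gap
  ... | inj₁ finished = gapBound-antimono (suc a) (smaller-gap (GreedyRun-profit-≤ P run AS A₁ AS-optimal A₁-optimal)) finished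
    where
    smaller-gap : profit P AS ≤ profit P A₁ → Opt - (profit P A₁ + profit P A₂) ≤ Opt - (profit P AS + profit P A₂)
    smaller-gap AS≤A₁ = ≤-by-difference (rearrange Opt (profit P AS) (profit P A₁) (profit P A₂)) (p≤q⇒0≤q-p AS≤A₁)
      where
      rearrange : ∀ o s f t → o - (s + t) - (o - (f + t)) ≡ f - s
      rearrange = solve-∀ ℚ-ring
  ... | inj₂ ((T , T∈inc) , next) with run
  ...   | stop no-inc = ⊥-elim (no-inc T T∈inc)
  ...   | step {S′} greedy run′ with optimal-exists P S′ (proj₂ (proj₁ (proj₁ greedy)))
  ...     | AS′ , AS′-optimal = finished-along run′ AS′ AS′-optimal (proj₁ (proj₁ greedy)) (next S′ greedy AS′ AS′-optimal) A₁ A₁-optimal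

  greedy-finished : ∀ {F} → GreedyRun P (S-empty P) F → ∀ A₁ → OptFor P F A₁ → Finished A₁
  greedy-finished run A₁ A₁-optimal with optimal-exists P (S-empty P) (subst (ℕ._≤ n) (sym (cost-S-empty P)) z≤n)
  ... | AS₀ , AS₀-optimal = finished-along run AS₀ AS₀-optimal (K0 , subst (ℕ._≤ n) (sym (cost-S-empty P)) z≤n) start A₁ A₁-optimal
    where
    start : GapAt (S-empty P) AS₀
    start rewrite cost-S-empty P = scaleˡ-≤ (fromℕ-nonNeg 1) (≤-by-difference (cancel Opt (profit P AS₀)) (profit-nonNeg P AS₀))
      where
      cancel : ∀ o s → o - (o - s) ≡ s
      cancel = solve-∀ ℚ-ring

zero-or-suc : ∀ k → k ≡ 0 ⊎ ∃ λ a → k ≡ suc a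
zero-or-suc zero    = inj₁ refl
zero-or-suc (suc a) = inj₂ (a , refl)

approximation : (P : SAP) → ∀ {F} → GreedyRun P (S-empty P) F → ∀ A₁ → OptFor P F A₁ → ∀ A₂ → IsA2 P (S-empty P) A₂ →
                ∀ A* → FeasibleAssignment P A* → ∀ {X} → 0ℚ ≤ X → profit P A₁ + profit P A₂ ≤ X + X →
                AtLeastConstTimes X (profit P A*)
approximation P run A₁ A₁-optimal A₂ A₂-best A* A*-feasible {X} 0≤X A₁+A₂≤2X with zero-or-suc (SAP.n P)
... | inj₁ n≡0 = λ q _ → subst (λ o → q * o ≤ X) (sym (sumℚ-empty _ n≡0)) (subst (_≤ X) (sym (*-zeroʳ q)) 0≤X)
... | inj₂ (a , n≡1+a) = gapBound-approximation {a} (profit-nonNeg P A*)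
                            (Analysis.greedy-finished P A* A*-feasible A₂ A₂-best a n≡1+a run A₁ A₁-optimal) A₁+A₂≤2X

theorem4 : (P : SAP) → ∀ {F} → GreedyRun P (S-empty P) F →
    ∀ A₁ → OptFor P F A₁ → ∀ A₂ → IsA2 P (S-empty P) A₂ →
    (profit P A₂ ≤ profit P A₁ →
       FeasibleAssignment P A₁ ×
       (∀ A* → FeasibleAssignment P A* → AtLeastConstTimes (profit P A₁) (profit P A*))) ×
    (profit P A₁ ≤ profit P A₂ →
       FeasibleAssignment P A₂ ×
       (∀ A* → FeasibleAssignment P A* → AtLeastConstTimes (profit P A₂) (profit P A*)))
theorem4 P run A₁ A₁-optimal A₂ A₂-best =
  (λ A₂≤A₁ → A₁-feasible , λ A* A*-feasible →
     approximation P run A₁ A₁-optimal A₂ A₂-best A* A*-feasible (profit-nonNeg P A₁) (+-monoʳ-≤ (profit P A₁) A₂≤A₁)) ,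
  (λ A₁≤A₂ → proj₁ A₂-best , λ A* A*-feasible →
     approximation P run A₁ A₁-optimal A₂ A₂-best A* A*-feasible (profit-nonNeg P A₂) (+-monoˡ-≤ (profit P A₂) A₁≤A₂))
  where
  A₁-feasible : FeasibleAssignment P A₁
  A₁-feasible b = subst (SAP.K P b) (sym (proj₁ A₁-optimal b)) (GreedyRun-isSelection P run (SAP.K0 P) b)
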